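{- For every integer $m\ge2$, the operator $\widetilde L_m=\sum_{j=0}^m\ell_{m,j}(u)D^j$ satisfies $\widetilde L_m^*=(-1)^m\widetilde L_m$, where $\widetilde L_m^*$ denotes its formal adjoint.
   Context: $D=\mathrm d/\mathrm du$ and $(\widehat\vartheta f)(u)=D[uf(u)]$. For $m\ge1$ the polynomials $\ell_{m,j}(u)$ ($0\le j\le m$) are defined by $\sum_{j=0}^m\ell_{m,j}(u)D^j=u\widehat\vartheta^m+\sum_{k=1}^{\lfloor m/2\rfloor+1}u^{1-k}\sum_{(\alpha_1,\dots,\alpha_k)}(\widehat\vartheta-k)^{m+1-\alpha_1}\prod_{n=1}^k\alpha_n(\alpha_n-m-2)(\widehat\vartheta-k+n)^{\alpha_n-\alpha_{n+1}}$, the inner sum over integer tuples with $1\le\alpha_n\le m+1$, $\alpha_{n+1}\le\alpha_n-2$ for $1\le n\le k-1$, and $\alpha_{k+1}:=1$. The formal adjoint of $\widehat O=\sum_{k=0}^na_k(u)D^k$ is $\widehat O^*f(u)=\sum_{k=0}^n(-1)^kD^k[a_k(u)f(u)]$. -}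

module Defs where

open import Data.Nat as ℕ using (ℕ; zero; suc; ⌊_/2⌋; _∸_; _≤ᵇ_)
open import Data.Integer as ℤ using (ℤ; +_; -_)
open import Data.Bool using (Bool; true; false; _∧_; if_then_else_)
open import Data.List using (List; []; _∷_; _++_; map; concatMap; filterᵇ; upTo)
open import Relation.Nullary.Decidable using (⌊_⌋)
open import Relation.Binary.PropositionalEquality using (_≡_)
open import Data.Nat.Combinatorics using (_C_)

-- Differential operators  Σ c · u^e · D^j  with integer coefficients and
-- Laurent-polynomial coefficients in u (e ∈ ℤ), i.e. elements of the Weyl
-- algebra localised at u.
record Term : Set where
  constructor term
  field
    c : ℤ
    e : ℤ
    j : ℕ

Op : Set
Op = List Term

coeff : Op → ℤ → ℕ → ℤ
coeff [] e j = + 0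
coeff (term c e' j' ∷ ts) e j =
  (if ⌊ e ℤ.≟ e' ⌋ ∧ ⌊ j ℕ.≟ j' ⌋ then c else + 0) ℤ.+ coeff ts e j

infix 4 _≈op_
_≈op_ : Op → Op → Set
A ≈op B = ∀ (e : ℤ) (j : ℕ) → coeff A e j ≡ coeff B e j

infixl 6 _⊕_
_⊕_ : Op → Op → Op
_⊕_ = _++_

scale : ℤ → Op → Op
scale a = map (λ { (term c e j) → term (a ℤ.* c) e j })

const : ℤ → Op
const a = term a (+ 0) 0 ∷ []

Dop : Op
Dop = term (+ 1) (+ 0) 1 ∷ []

uPow : ℤ → Op
uPow e = term (+ 1) e 0 ∷ []

DPow : ℕ → Op
DPow j = term (+ 1) (+ 0) j ∷ []

ff : ℤ → ℕ → ℤ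
ff e zero = + 1
ff e (suc i) = ff e i ℤ.* (e ℤ.- + i)

binom : ℕ → ℕ → ℤ
binom n k = + (n C k)

-- composition of monomials, via Leibniz:
-- (c₁ u^e₁ D^j₁)(c₂ u^e₂ D^j₂)
--   = Σ_{i=0}^{j₁} c₁ c₂ C(j₁,i) (e₂)_i u^{e₁+e₂-i} D^{j₁-i+j₂}
mulTerm : Term → Term → Op
mulTerm (term c₁ e₁ j₁) (term c₂ e₂ j₂) =
  map (λ i → term (c₁ ℤ.* c₂ ℤ.* binom j₁ i ℤ.* ff e₂ i)
                  (e₁ ℤ.+ e₂ ℤ.- + i) ((j₁ ∸ i) ℕ.+ j₂))
      (upTo (suc j₁))

infixl 7 _⊗_
_⊗_ : Op → Op → Op
A ⊗ B = concatMap (λ s → concatMap (mulTerm s) B) A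

pow : Op → ℕ → Op
pow A zero = const (+ 1)
pow A (suc n) = A ⊗ pow A n

-- formal adjoint:  (Σ a_k D^k)^* f = Σ (-1)^k D^k [a_k f],
-- i.e. as an operator  Σ (-1)^k D^k ∘ a_k
adjoint : Op → Op
adjoint = concatMap (λ { (term c e j) →
  scale (c ℤ.* ((ℤ.- (+ 1)) ℤ.^ j)) (DPow j ⊗ uPow e) })

ϑ̂ : Op
ϑ̂ = Dop ⊗ uPow (+ 1)

ϑ̂+ : ℤ → Op
ϑ̂+ a = ϑ̂ ⊕ const a

allLists : ℕ → List ℕ → List (List ℕ)
allLists zero vs = [] ∷ []
allLists (suc k) vs = concatMap (λ a → map (a ∷_) (allLists k vs)) vs

gapChain : List ℕ → Bool
gapChain (a ∷ b ∷ rest) = ((b ℕ.+ 2) ≤ᵇ a) ∧ gapChain (b ∷ rest)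
gapChain _ = true

tuples : ℕ → ℕ → List (List ℕ)
tuples m k = filterᵇ gapChain (allLists k (map suc (upTo (suc m))))

-- ∏_{n = n₀}^{k} α_n (α_n - m - 2) (ϑ̂ - k + n)^{α_n - α_{n+1}},  α_{k+1} := 1,
-- given the list [α_{n₀}, …, α_k]
prodPart : ℕ → ℕ → ℕ → List ℕ → Op
prodPart m k n [] = const (+ 1)
prodPart m k n (a ∷ rest) =
  scale (+ a ℤ.* (+ a ℤ.- + (m ℕ.+ 2)))
        (pow (ϑ̂+ (+ n ℤ.- + k)) (a ∸ next rest))
  ⊗ prodPart m k (suc n) rest
  where
  next : List ℕ → ℕ
  next [] = 1
  next (b ∷ _) = b

summand : ℕ → ℕ → List ℕ → Op
summand m k [] = prodPart m k 1 []
summand m k (a₁ ∷ rest) =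
  pow (ϑ̂+ (ℤ.- (+ k))) (suc m ∸ a₁) ⊗ prodPart m k 1 (a₁ ∷ rest)

sumOps : List Op → Op
sumOps [] = []
sumOps (A ∷ As) = A ⊕ sumOps As

outer : ℕ → ℕ → Op
outer m zero = []
outer m (suc K) =
  outer m K ⊕
  uPow (+ 1 ℤ.- + suc K) ⊗ sumOps (map (summand m (suc K)) (tuples m (suc K)))

-- L̃_m = Σ_j ℓ_{m,j}(u) D^j
--     = u ϑ̂^m + Σ_{k=1}^{⌊m/2⌋+1} u^{1-k} Σ_α (ϑ̂-k)^{m+1-α_1} ∏ …
Ltilde : ℕ → Op
Ltilde m = uPow (+ 1) ⊗ pow ϑ̂ m ⊕ outer m (suc ⌊ m /2⌋)

-- ℓ_{m,j}(u) as its coefficient function (coefficient of u^e)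
ℓ : ℕ → ℕ → ℤ → ℤ
ℓ m j e = coeff (Ltilde m) e j

-- An operator acts on Laurent monomials by  u^e D^j · u^s = s(s-1)⋯(s-j+1) u^(s+e-j),  and it is
-- determined by its matrix entries (the coefficient of u^(s+d) in A u^s, for s, d ∈ ℤ): at s = j ∈ ℕ
-- every term with more than j derivatives vanishes, so the coefficients are recovered by induction on j.
-- The formal adjoint is the transpose for the residue pairing ⟨u^a, u^b⟩ = [a + b = -1], so A* = ε A
-- says that the entry at (-s-d-1, d) is ε times the entry at (s, d).
--
-- Each piece u^d g(ϑ̂) of L̃ₘ maps u^s to g(s) u^(s+d), since ϑ̂ u^s = (s+1) u^s; so it suffices that
-- g(-s-d-1) = (-1)^m g(s). For u ϑ̂^m this is (-s-1)^m = (-1)^m (s+1)^m. In the layer u^(1-k) Σ_α the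
-- α-summand has symbol  ∏ₙ αₙ(αₙ-m-2) · ∏ᵢ (s+1-k+i)^eᵢ,  where e₀, …, e_k are the successive
-- differences of the chain m+1 ≥ α₁ ≥ ⋯ ≥ α_k ≥ 1. Under s ↦ k-2-s the second product becomes
-- (-1)^(Σ eᵢ) times the product with the exponents reversed, which is the symbol of the mirrored tuple
-- (m+2-α_k, …, m+2-α₁). Mirroring permutes the admissible tuples and preserves the weights αₙ(αₙ-m-2),
-- and Σ eᵢ = m by telescoping.

module Submission where

open import Defs
open import Data.Nat as ℕ using (ℕ; zero; suc; _∸_; _≤_; _<_; z≤n; s≤s; ⌊_/2⌋; _≤ᵇ_)
open import Data.Nat.Induction using (<-rec)
open import Data.Nat.Combinatorics using (_C_; nCk+nC[k+1]≡[n+1]C[k+1])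
open import Data.Nat.Combinatorics.Specification using (k>n⇒nCk≡0)
import Data.Nat.Properties as ℕP
open import Data.Integer as ℤ using (ℤ; +_; -_; _+_; _*_; _-_; _^_)
import Data.Integer.Properties as ℤP
open import Data.Integer.Tactic.RingSolver using (solve-∀)
open import Data.Bool using (Bool; true; false; if_then_else_; _∧_; T; T?)
open import Data.Unit using (tt)
import Data.Bool.Properties as BoolP
open import Data.List using (List; []; _∷_; _++_; _∷ʳ_; length; reverse; head; filterᵇ; map; concatMap; applyUpTo; upTo)
open import Data.Bool.ListAction using (and)
open import Data.Nat.ListAction using (sum)
import Data.List.Properties as ListP
open import Data.Product using (_×_; _,_; uncurry; swap; proj₁)
import Data.Product as Product
open import Data.Sum using (inj₁; inj₂)
open import Data.List.Relation.Unary.All as All using (All; []; _∷_)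
import Data.List.Relation.Unary.All.Properties as AllP
open import Data.Empty using (⊥-elim)
open import Data.Maybe.Relation.Unary.All using (just)
import Data.Maybe.Relation.Unary.All as Maybe
open import Relation.Binary.PropositionalEquality
open import Relation.Nullary using (¬_; yes; no)
open import Relation.Nullary.Decidable using (⌊_⌋; does-⇔)
open import Function.Bundles using (mk⇔)
open import Function using (_∘_)

^-distrib-* : ∀ x y n → (x * y) ^ n ≡ x ^ n * y ^ n
^-distrib-* x y zero = refl
^-distrib-* x y (suc n) = trans (cong (x * y *_) (^-distrib-* x y n)) (regroup x y (x ^ n) (y ^ n))
  where
  regroup : ∀ x y a b → x * y * (a * b) ≡ x * a * (y * b)
  regroup = solve-∀

i-k≡j-k⇒i≡j : ∀ i j k → i - k ≡ j - k → i ≡ j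
i-k≡j-k⇒i≡j i j k eq = trans (sym (restore i k)) (trans (cong (_+ k) eq) (restore j k))
  where
  restore : ∀ i k → i - k + k ≡ i
  restore = solve-∀

-- Finite sums

∑< : ℕ → (ℕ → ℤ) → ℤ
∑< zero f = + 0
∑< (suc n) f = f 0 + ∑< n (f ∘ suc)

∑<-+ : ∀ n f g → ∑< n (λ i → f i + g i) ≡ ∑< n f + ∑< n g
∑<-+ zero f g = refl
∑<-+ (suc n) f g =
  trans (cong (_+_ (f 0 + g 0)) (∑<-+ n (f ∘ suc) (g ∘ suc))) (regroup (f 0) (g 0) _ _)
  where
  regroup : ∀ a b c d → (a + b) + (c + d) ≡ (a + c) + (b + d)
  regroup = solve-∀

∑<-*ˡ : ∀ n a f → ∑< n (λ i → a * f i) ≡ a * ∑< n f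
∑<-*ˡ zero a f = sym (ℤP.*-zeroʳ a)
∑<-*ˡ (suc n) a f =
  trans (cong (_+_ (a * f 0)) (∑<-*ˡ n a (f ∘ suc))) (sym (ℤP.*-distribˡ-+ a (f 0) _))

∑<-cong : ∀ n {f g} → (∀ i → i < n → f i ≡ g i) → ∑< n f ≡ ∑< n g
∑<-cong zero f≗g = refl
∑<-cong (suc n) f≗g = cong₂ _+_ (f≗g 0 (s≤s z≤n)) (∑<-cong n (λ i i<n → f≗g (suc i) (s≤s i<n)))

∑<-last : ∀ n f → ∑< (suc n) f ≡ ∑< n f + f n
∑<-last zero f = trans (ℤP.+-identityʳ (f 0)) (sym (ℤP.+-identityˡ (f 0)))
∑<-last (suc n) f =
  trans (cong (_+_ (f 0)) (∑<-last n (f ∘ suc))) (sym (ℤP.+-assoc (f 0) _ (f (suc n))))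

∑<-reverse : ∀ n f → ∑< n (λ i → f (n ∸ suc i)) ≡ ∑< n f
∑<-reverse zero f = refl
∑<-reverse (suc n) f =
  trans (cong (_+_ (f n)) (∑<-reverse n f))
        (trans (ℤP.+-comm (f n) (∑< n f)) (sym (∑<-last n f)))

∑ : {X : Set} → List X → (X → ℤ) → ℤ
∑ [] f = + 0
∑ (x ∷ xs) f = f x + ∑ xs f

module _ {X : Set} where

  ∑-++ : ∀ (xs ys : List X) f → ∑ (xs ++ ys) f ≡ ∑ xs f + ∑ ys f
  ∑-++ [] ys f = sym (ℤP.+-identityˡ _)
  ∑-++ (x ∷ xs) ys f = trans (cong (_+_ (f x)) (∑-++ xs ys f)) (sym (ℤP.+-assoc (f x) (∑ xs f) (∑ ys f)))

  ∑-cong : ∀ (xs : List X) {f g} → (∀ x → f x ≡ g x) → ∑ xs f ≡ ∑ xs g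
  ∑-cong [] f≗g = refl
  ∑-cong (x ∷ xs) f≗g = cong₂ _+_ (f≗g x) (∑-cong xs f≗g)

  ∑-cong-local : ∀ {xs : List X} {f g} → All (λ x → f x ≡ g x) xs → ∑ xs f ≡ ∑ xs g
  ∑-cong-local [] = refl
  ∑-cong-local (fx≡gx ∷ f≗g) = cong₂ _+_ fx≡gx (∑-cong-local f≗g)

  ∑-+ : ∀ (xs : List X) f g → ∑ xs (λ x → f x + g x) ≡ ∑ xs f + ∑ xs g
  ∑-+ [] f g = refl
  ∑-+ (x ∷ xs) f g = trans (cong (_+_ (f x + g x)) (∑-+ xs f g)) (regroup (f x) (g x) (∑ xs f) (∑ xs g))
    where
    regroup : ∀ a b c d → a + b + (c + d) ≡ a + c + (b + d)
    regroup = solve-∀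

  ∑-*ˡ : ∀ (xs : List X) a f → ∑ xs (λ x → a * f x) ≡ a * ∑ xs f
  ∑-*ˡ [] a f = sym (ℤP.*-zeroʳ a)
  ∑-*ˡ (x ∷ xs) a f = trans (cong (_+_ (a * f x)) (∑-*ˡ xs a f)) (sym (ℤP.*-distribˡ-+ a (f x) (∑ xs f)))

  ∑-0 : ∀ (xs : List X) → ∑ xs (λ _ → + 0) ≡ + 0
  ∑-0 [] = refl
  ∑-0 (x ∷ xs) = trans (ℤP.+-identityˡ _) (∑-0 xs)

  ∑-filterᵇ : ∀ (xs : List X) p f → ∑ (filterᵇ p xs) f ≡ ∑ xs (λ x → if p x then f x else + 0)
  ∑-filterᵇ [] p f = refl
  ∑-filterᵇ (x ∷ xs) p f with p x
  ... | true = cong (_+_ (f x)) (∑-filterᵇ xs p f)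
  ... | false = trans (∑-filterᵇ xs p f) (sym (ℤP.+-identityˡ _))

module _ {X Y : Set} where

  ∑-map : ∀ (h : X → Y) xs g → ∑ (map h xs) g ≡ ∑ xs (g ∘ h)
  ∑-map h [] g = refl
  ∑-map h (x ∷ xs) g = cong (_+_ (g (h x))) (∑-map h xs g)

  ∑-concatMap : ∀ (h : X → List Y) xs g → ∑ (concatMap h xs) g ≡ ∑ xs (λ x → ∑ (h x) g)
  ∑-concatMap h [] g = refl
  ∑-concatMap h (x ∷ xs) g = trans (∑-++ (h x) (concatMap h xs) g) (cong (_+_ (∑ (h x) g)) (∑-concatMap h xs g))

  ∑-comm : ∀ (xs : List X) (ys : List Y) (f : X → Y → ℤ) →
    ∑ xs (λ x → ∑ ys (f x)) ≡ ∑ ys (λ y → ∑ xs (λ x → f x y))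
  ∑-comm [] ys f = sym (∑-0 ys)
  ∑-comm (x ∷ xs) ys f =
    trans (cong (_+_ (∑ ys (f x))) (∑-comm xs ys f)) (sym (∑-+ ys (f x) (λ y → ∑ xs (λ x′ → f x′ y))))

∑-applyUpTo : ∀ (h : ℕ → ℕ) n g → ∑ (applyUpTo h n) g ≡ ∑< n (g ∘ h)
∑-applyUpTo h zero g = refl
∑-applyUpTo h (suc n) g = cong (_+_ (g (h 0))) (∑-applyUpTo (h ∘ suc) n g)

-- Falling factorials

ff-suc : ∀ x k → ff x (suc k) ≡ x * ff (x - + 1) k
ff-suc x zero = shift x
  where
  shift : ∀ x → + 1 * (x - + 0) ≡ x * + 1
  shift = solve-∀
ff-suc x (suc k) = trans (cong (_* (x - + suc k)) (ff-suc x k)) (shift x (ff (x - + 1) k) (+ k))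
  where
  shift : ∀ x f k → x * f * (x - (+ 1 + k)) ≡ x * (f * (x - + 1 - k))
  shift = solve-∀

ff-+ : ∀ x a q → ff x (a ℕ.+ q) ≡ ff x q * ff (x - + q) a
ff-+ x zero q = sym (ℤP.*-identityʳ (ff x q))
ff-+ x (suc a) q =
  trans (cong₂ (λ f n → f * (x - n)) (ff-+ x a q) (ℤP.pos-+ a q))
        (shift (ff x q) (ff (x - + q) a) x (+ a) (+ q))
  where
  shift : ∀ f g x a q → f * g * (x - (a + q)) ≡ f * (g * (x - q - a))
  shift = solve-∀

ff-reflect : ∀ z j → (- + 1) ^ j * ff z j ≡ ff (+ j - + 1 - z) j
ff-reflect z zero = refl
ff-reflect z (suc j) = begin
  (- + 1) * (- + 1) ^ j * (ff z j * (z - + j))   ≡⟨ regroup ((- + 1) ^ j) (ff z j) z (+ j) ⟩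
  (+ j - z) * ((- + 1) ^ j * ff z j)             ≡⟨ cong ((+ j - z) *_) (ff-reflect z j) ⟩
  (+ j - z) * ff (+ j - + 1 - z) j               ≡⟨ cong (λ y → (+ j - z) * ff y j) (shift z (+ j)) ⟩
  (+ j - z) * ff (+ j - z - + 1) j               ≡⟨ sym (ff-suc (+ j - z) j) ⟩
  ff (+ j - z) (suc j)                           ≡⟨ cong (λ y → ff y (suc j)) (shift′ z (+ j)) ⟩
  ff (+ suc j - + 1 - z) (suc j)                 ∎
  where
  open ≡-Reasoning
  regroup : ∀ s f z j → (- + 1) * s * (f * (z - j)) ≡ (j - z) * (s * f)
  regroup = solve-∀
  shift : ∀ z j → j - + 1 - z ≡ j - z - + 1
  shift = solve-∀
  shift′ : ∀ z j → j - z ≡ + 1 + j - + 1 - z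
  shift′ = solve-∀

vandermonde : ∀ n x y → ∑< (suc n) (λ i → + (n C i) * ff y i * ff x (n ∸ i)) ≡ ff (x + y) n
vandermonde zero x y = refl
vandermonde (suc n) x y = sym (begin
  ff (x + y) n * (x + y - + n)                   ≡⟨ cong (_* (x + y - + n)) (sym (vandermonde n x y)) ⟩
  ∑< (suc n) t * (x + y - + n)                    ≡⟨ ℤP.*-comm _ (x + y - + n) ⟩
  (x + y - + n) * ∑< (suc n) t                    ≡⟨ sym (∑<-*ˡ (suc n) (x + y - + n) t) ⟩
  ∑< (suc n) (λ i → (x + y - + n) * t i)          ≡⟨ ∑<-cong (suc n) split ⟩
  ∑< (suc n) (λ i → p i + a i)                    ≡⟨ ∑<-+ (suc n) p a ⟩
  p 0 + ∑< n (p ∘ suc) + ∑< (suc n) a             ≡⟨ cong (λ t → p 0 + t + ∑< (suc n) a) pad ⟩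
  p 0 + ∑< (suc n) (p ∘ suc) + ∑< (suc n) a       ≡⟨ ℤP.+-assoc (p 0) _ _ ⟩
  p 0 + (∑< (suc n) (p ∘ suc) + ∑< (suc n) a)     ≡⟨ cong (_+_ (p 0)) (sym (∑<-+ (suc n) (p ∘ suc) a)) ⟩
  p 0 + ∑< (suc n) (λ i → p (suc i) + a i)        ≡⟨ cong (_+_ (p 0)) (∑<-cong (suc n) (λ i _ → pascal i)) ⟩
  ∑< (suc (suc n)) t′                             ∎)
  where
  open ≡-Reasoning
  t p a t′ : ℕ → ℤ
  t i = + (n C i) * ff y i * ff x (n ∸ i)
  p i = + (n C i) * ff y i * ff x (suc n ∸ i)
  a i = + (n C i) * ff y (suc i) * ff x (n ∸ i)
  t′ i = + (suc n C i) * ff y i * ff x (suc n ∸ i)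
  split : ∀ i → i < suc n → (x + y - + n) * t i ≡ p i + a i
  split i (s≤s i≤n) = begin
    (x + y - + n) * t i
      ≡⟨ cong (λ k → (x + y - k) * t i)
              (trans (cong +_ (sym (ℕP.m∸n+n≡m i≤n))) (ℤP.pos-+ (n ∸ i) i)) ⟩
    (x + y - (+ (n ∸ i) + + i)) * t i
      ≡⟨ distrib (+ (n C i)) (ff y i) (ff x (n ∸ i)) x y (+ (n ∸ i)) (+ i) ⟩
    + (n C i) * ff y i * (ff x (n ∸ i) * (x - + (n ∸ i))) + a i
      ≡⟨ cong (λ k → + (n C i) * ff y i * ff x k + a i) (sym (ℕP.+-∸-assoc 1 i≤n)) ⟩
    p i + a i ∎
    where
    distrib : ∀ c g f x y a b → (x + y - (a + b)) * (c * g * f) ≡ c * g * (f * (x - a)) + c * (g * (y - b)) * f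
    distrib = solve-∀
  pad : ∑< n (p ∘ suc) ≡ ∑< (suc n) (p ∘ suc)
  pad = sym (begin
    ∑< (suc n) (p ∘ suc)
      ≡⟨ ∑<-last n (p ∘ suc) ⟩
    ∑< n (p ∘ suc) + p (suc n)
      ≡⟨ cong (λ c → ∑< n (p ∘ suc) + + c * ff y (suc n) * ff x (n ∸ n)) (k>n⇒nCk≡0 (ℕP.n<1+n n)) ⟩
    ∑< n (p ∘ suc) + + 0
      ≡⟨ ℤP.+-identityʳ _ ⟩
    ∑< n (p ∘ suc) ∎)
  pascal : ∀ i → p (suc i) + a i ≡ t′ (suc i)
  pascal i = begin
    p (suc i) + a i
      ≡⟨ distrib (+ (n C suc i)) (+ (n C i)) (ff y (suc i)) (ff x (n ∸ i)) ⟩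
    (+ (n C i) + + (n C suc i)) * ff y (suc i) * ff x (n ∸ i)
      ≡⟨ cong (λ c → c * ff y (suc i) * ff x (n ∸ i))
              (trans (sym (ℤP.pos-+ (n C i) (n C suc i))) (cong +_ (nCk+nC[k+1]≡[n+1]C[k+1] n i))) ⟩
    t′ (suc i) ∎
    where
    distrib : ∀ a b g f → a * g * f + b * g * f ≡ (b + a) * g * f
    distrib = solve-∀

ff-vanishes : ∀ {n k} → n < k → ff (+ n) k ≡ + 0
ff-vanishes {n} {suc k} (s≤s n≤k) with ℕP.m≤n⇒m<n∨m≡n n≤k
... | inj₁ n<k = cong (_* (+ n - + k)) (ff-vanishes n<k)
... | inj₂ refl = trans (cong (ff (+ n) n *_) (ℤP.+-inverseʳ (+ n))) (ℤP.*-zeroʳ (ff (+ n) n))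

ff-diag≢0 : ∀ n → ff (+ n) n ≢ + 0
ff-diag≢0 zero ()
ff-diag≢0 (suc n) ffₙ≡0 with ℤP.i*j≡0⇒i≡0∨j≡0 (+ suc n) (trans (sym (ff-suc (+ suc n) n)) ffₙ≡0)
... | inj₂ ff≡0 = ff-diag≢0 n ff≡0

-- Linear functionals on operators

lin : (ℤ → ℕ → ℤ) → Op → ℤ
lin w [] = + 0
lin w (term c e j ∷ A) = c * w e j + lin w A

lin-++ : ∀ w A B → lin w (A ++ B) ≡ lin w A + lin w B
lin-++ w [] B = sym (ℤP.+-identityˡ _)
lin-++ w (term c e j ∷ A) B =
  trans (cong (_+_ (c * w e j)) (lin-++ w A B)) (sym (ℤP.+-assoc (c * w e j) (lin w A) (lin w B)))

lin-scale : ∀ w a A → lin w (scale a A) ≡ a * lin w A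
lin-scale w a [] = sym (ℤP.*-zeroʳ a)
lin-scale w a (term c e j ∷ A) =
  trans (cong (_+_ (a * c * w e j)) (lin-scale w a A)) (distrib a c (w e j) (lin w A))
  where
  distrib : ∀ a c x y → a * c * x + a * y ≡ a * (c * x + y)
  distrib = solve-∀

lin-cong : ∀ {w w′} → (∀ e j → w e j ≡ w′ e j) → ∀ A → lin w A ≡ lin w′ A
lin-cong w≗w′ [] = refl
lin-cong w≗w′ (term c e j ∷ A) = cong₂ (λ x y → c * x + y) (w≗w′ e j) (lin-cong w≗w′ A)

lin-+ʷ : ∀ v w A → lin (λ e j → v e j + w e j) A ≡ lin v A + lin w A
lin-+ʷ v w [] = refl
lin-+ʷ v w (term c e j ∷ A) =
  trans (cong (_+_ (c * (v e j + w e j))) (lin-+ʷ v w A))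
        (distrib c (v e j) (w e j) (lin v A) (lin w A))
  where
  distrib : ∀ c x y a b → c * (x + y) + (a + b) ≡ (c * x + a) + (c * y + b)
  distrib = solve-∀

lin-*ʷ : ∀ a w A → lin (λ e j → a * w e j) A ≡ a * lin w A
lin-*ʷ a w [] = sym (ℤP.*-zeroʳ a)
lin-*ʷ a w (term c e j ∷ A) =
  trans (cong (_+_ (c * (a * w e j))) (lin-*ʷ a w A)) (distrib c a (w e j) (lin w A))
  where
  distrib : ∀ c a x y → c * (a * x) + a * y ≡ a * (c * x + y)
  distrib = solve-∀

lin-0ʷ : ∀ {w} → (∀ e j → w e j ≡ + 0) → ∀ A → lin w A ≡ + 0
lin-0ʷ w≗0 [] = refl
lin-0ʷ w≗0 (term c e j ∷ A) =
  trans (cong₂ (λ x y → c * x + y) (w≗0 e j) (lin-0ʷ w≗0 A)) (trans (ℤP.+-identityʳ _) (ℤP.*-zeroʳ c))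

hits : ℤ → ℕ → ℤ → ℕ → Bool
hits e j e′ j′ = ⌊ e ℤ.≟ e′ ⌋ ∧ ⌊ j ℕ.≟ j′ ⌋

unit : ℤ → ℕ → ℤ → ℕ → ℤ
unit e j e′ j′ = if hits e j e′ j′ then + 1 else + 0

coeff-as-lin : ∀ X e j → coeff X e j ≡ lin (unit e j) X
coeff-as-lin [] e j = refl
coeff-as-lin (term c e′ j′ ∷ X) e j = cong₂ _+_ (if-as-* (hits e j e′ j′)) (coeff-as-lin X e j)
  where
  if-as-* : ∀ b → (if b then c else + 0) ≡ c * (if b then + 1 else + 0)
  if-as-* true = sym (ℤP.*-identityʳ c)
  if-as-* false = sym (ℤP.*-zeroʳ c)

hits-refl : ∀ e j → hits e j e j ≡ true
hits-refl e j with e ℤ.≟ e | j ℕ.≟ j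
... | yes _ | yes _ = refl
... | no e≢e | _ = ⊥-elim (e≢e refl)
... | yes _ | no j≢j = ⊥-elim (j≢j refl)

hits-≢ : ∀ {e j e′ j′} → ¬ (e ≡ e′ × j ≡ j′) → hits e j e′ j′ ≡ false
hits-≢ {e} {j} {e′} {j′} ne with e ℤ.≟ e′ | j ℕ.≟ j′
... | yes refl | yes refl = ⊥-elim (ne (refl , refl))
... | yes _ | no _ = refl
... | no _ | _ = refl

hits⇒≡ : ∀ {e j e′ j′} → hits e j e′ j′ ≡ true → e ≡ e′ × j ≡ j′
hits⇒≡ {e} {j} {e′} {j′} h with e ℤ.≟ e′ | j ℕ.≟ j′
hits⇒≡ h | yes p | yes q = p , q

without : ℤ → ℕ → Op → Op
without e j [] = []
without e j (term c e′ j′ ∷ X) =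
  if hits e j e′ j′ then without e j X else term c e′ j′ ∷ without e j X

lin-without : ∀ w e j X → lin w X ≡ w e j * coeff X e j + lin w (without e j X)
lin-without w e j [] = sym (trans (ℤP.+-identityʳ _) (ℤP.*-zeroʳ (w e j)))
lin-without w e j (term c e′ j′ ∷ X) with hits e j e′ j′ in h
... | true with refl , refl ← hits⇒≡ {e} {j} {e′} {j′} h =
  trans (cong (_+_ (c * w e j)) (lin-without w e j X)) (regroup c (w e j) (coeff X e j) _)
  where
  regroup : ∀ c x k r → c * x + (x * k + r) ≡ x * (c + k) + r
  regroup = solve-∀
... | false =
  trans (cong (_+_ (c * w e′ j′)) (lin-without w e j X)) (regroup (c * w e′ j′) (w e j) (coeff X e j) _)
  where
  regroup : ∀ t x k r → t + (x * k + r) ≡ x * (+ 0 + k) + (t + r)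
  regroup = solve-∀

coeff-without-≡ : ∀ e j X → coeff (without e j X) e j ≡ + 0
coeff-without-≡ e j [] = refl
coeff-without-≡ e j (term c e′ j′ ∷ X) with hits e j e′ j′ in h
... | true = coeff-without-≡ e j X
... | false = cong₂ _+_ (cong (λ b → if b then c else + 0) h) (coeff-without-≡ e j X)

coeff-without-≢ : ∀ {e j e′ j′} X → ¬ (e ≡ e′ × j ≡ j′) →
  coeff (without e j X) e′ j′ ≡ coeff X e′ j′
coeff-without-≢ [] ne = refl
coeff-without-≢ {e} {j} {e′} {j′} (term c e″ j″ ∷ X) ne with hits e j e″ j″ in h
... | true with refl , refl ← hits⇒≡ {e} {j} {e″} {j″} h =
  trans (coeff-without-≢ X ne)
        (sym (trans (cong (λ b → (if b then c else + 0) + coeff X e′ j′) (hits-≢ (λ (p , q) → ne (sym p , sym q))))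
                    (ℤP.+-identityˡ _)))
... | false = cong (_+_ (if hits e′ j′ e″ j″ then c else + 0)) (coeff-without-≢ X ne)

length-without : ∀ e j X → length (without e j X) ≤ length X
length-without e j [] = z≤n
length-without e j (term c e′ j′ ∷ X) with hits e j e′ j′
... | true = ℕP.m≤n⇒m≤1+n (length-without e j X)
... | false = s≤s (length-without e j X)

without-head : ∀ c e j X → without e j (term c e j ∷ X) ≡ without e j X
without-head c e j X rewrite hits-refl e j = refl

lin-vanishes : ∀ w X → (∀ e j → w e j * coeff X e j ≡ + 0) → lin w X ≡ + 0
lin-vanishes w X = go (length X) X ℕP.≤-refl
  where
  go : ∀ n X → length X ≤ n → (∀ e j → w e j * coeff X e j ≡ + 0) → lin w X ≡ + 0
  go _ [] _ _ = refl
  go (suc n) X@(term c e j ∷ X′) (s≤s |X′|≤n) vanish = begin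
    lin w X                                        ≡⟨ lin-without w e j X ⟩
    w e j * coeff X e j + lin w (without e j X)    ≡⟨ cong₂ _+_ (vanish e j) (go n (without e j X) shorter vanish′) ⟩
    + 0                                            ∎
    where
    open ≡-Reasoning
    shorter : length (without e j X) ≤ n
    shorter rewrite without-head c e j X′ = ℕP.≤-trans (length-without e j X′) |X′|≤n
    elsewhere : ∀ {e′ j′} → ¬ (e ≡ e′ × j ≡ j′) → w e′ j′ * coeff (without e j X) e′ j′ ≡ + 0
    elsewhere {e′} {j′} ne = trans (cong (w e′ j′ *_) (coeff-without-≢ {e} {j} {e′} {j′} X ne)) (vanish e′ j′)
    vanish′ : ∀ e′ j′ → w e′ j′ * coeff (without e j X) e′ j′ ≡ + 0
    vanish′ e′ j′ with e ℤ.≟ e′ | j ℕ.≟ j′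
    ... | yes refl | yes refl = trans (cong (w e j *_) (coeff-without-≡ e j X)) (ℤP.*-zeroʳ (w e j))
    ... | yes _ | no j≢j′ = elsewhere (j≢j′ ∘ λ (_ , q) → q)
    ... | no e≢e′ | _ = elsewhere (e≢e′ ∘ λ (p , _) → p)

-- The action on Laurent monomials

-- If  A u^s = Σ_k a_k u^(s+k),  then  onPower s G A = Σ_k a_k G k.
onPower : ℤ → (ℤ → ℤ) → Op → ℤ
onPower s G = lin (λ e j → ff s j * G (e - + j))

δ : ℤ → ℤ → ℤ
δ d k = if ⌊ k ℤ.≟ d ⌋ then + 1 else + 0

entry : ℤ → ℤ → Op → ℤ
entry s d = onPower s (δ d)

δ-refl : ∀ d → δ d d ≡ + 1
δ-refl d with d ℤ.≟ d
... | yes _ = refl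
... | no d≢d = ⊥-elim (d≢d refl)

δ-≢ : ∀ {d k} → k ≢ d → δ d k ≡ + 0
δ-≢ {d} {k} k≢d with k ℤ.≟ d
... | yes k≡d = ⊥-elim (k≢d k≡d)
... | no _ = refl

*-δ-cong : ∀ {x y} d k → (k ≡ d → x ≡ y) → x * δ d k ≡ y * δ d k
*-δ-cong {x} {y} d k x≡y with k ℤ.≟ d
... | yes k≡d = cong (_* + 1) (x≡y k≡d)
... | no _ = trans (ℤP.*-zeroʳ x) (sym (ℤP.*-zeroʳ y))

lin-map-applyUpTo : ∀ w (c e : ℕ → ℤ) (j : ℕ → ℕ) g n →
  lin w (map (λ i → term (c i) (e i) (j i)) (applyUpTo g n)) ≡ ∑< n (λ i → c (g i) * w (e (g i)) (j (g i)))
lin-map-applyUpTo w c e j g zero = refl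
lin-map-applyUpTo w c e j g (suc n) = cong (_+_ (c (g 0) * w (e (g 0)) (j (g 0)))) (lin-map-applyUpTo w c e j (g ∘ suc) n)

onPower-mulTerm : ∀ s G c₁ e₁ j₁ c₂ e₂ j₂ →
  onPower s G (mulTerm (term c₁ e₁ j₁) (term c₂ e₂ j₂))
  ≡ c₂ * (ff s j₂ * onPower (s + (e₂ - + j₂)) (λ k → G (k + (e₂ - + j₂))) (term c₁ e₁ j₁ ∷ []))
onPower-mulTerm s G c₁ e₁ j₁ c₂ e₂ j₂ = begin
  onPower s G (mulTerm (term c₁ e₁ j₁) (term c₂ e₂ j₂))
    ≡⟨ lin-map-applyUpTo _ (λ i → c₁ * c₂ * binom j₁ i * ff e₂ i) (λ i → e₁ + e₂ - + i)
                           (λ i → (j₁ ∸ i) ℕ.+ j₂) (λ i → i) (suc j₁) ⟩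
  ∑< (suc j₁) (λ i → c₁ * c₂ * binom j₁ i * ff e₂ i
                     * (ff s ((j₁ ∸ i) ℕ.+ j₂) * G (e₁ + e₂ - + i - + ((j₁ ∸ i) ℕ.+ j₂))))
    ≡⟨ ∑<-cong (suc j₁) leibniz-term ⟩
  ∑< (suc j₁) (λ i → M * (+ (j₁ C i) * ff e₂ i * ff (s - + j₂) (j₁ ∸ i)))
    ≡⟨ ∑<-*ˡ (suc j₁) M (λ i → + (j₁ C i) * ff e₂ i * ff (s - + j₂) (j₁ ∸ i)) ⟩
  M * ∑< (suc j₁) (λ i → + (j₁ C i) * ff e₂ i * ff (s - + j₂) (j₁ ∸ i))
    ≡⟨ cong (M *_) (vandermonde j₁ (s - + j₂) e₂) ⟩
  M * ff (s - + j₂ + e₂) j₁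
    ≡⟨ cong (λ x → M * ff x j₁) (shift s (+ j₂) e₂) ⟩
  M * ff (s + (e₂ - + j₂)) j₁
    ≡⟨ regroup c₁ c₂ (ff s j₂) (G K) (ff (s + (e₂ - + j₂)) j₁) ⟩
  c₂ * (ff s j₂ * (c₁ * (ff (s + (e₂ - + j₂)) j₁ * G K) + + 0))  ∎
  where
  open ≡-Reasoning
  K = (e₁ - + j₁) + (e₂ - + j₂)
  M = c₁ * c₂ * ff s j₂ * G K
  shift : ∀ s j e → s - j + e ≡ s + (e - j)
  shift = solve-∀
  regroup : ∀ c₁ c₂ f g h → c₁ * c₂ * f * g * h ≡ c₂ * (f * (c₁ * (h * g) + + 0))
  regroup = solve-∀
  offset : ∀ i → i ≤ j₁ → e₁ + e₂ - + i - + ((j₁ ∸ i) ℕ.+ j₂) ≡ K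
  offset i i≤j₁ = begin
    e₁ + e₂ - + i - + ((j₁ ∸ i) ℕ.+ j₂)
      ≡⟨ cong (λ n → e₁ + e₂ - + i - n) (ℤP.pos-+ (j₁ ∸ i) j₂) ⟩
    e₁ + e₂ - + i - (+ (j₁ ∸ i) + + j₂)
      ≡⟨ regroup′ e₁ e₂ (+ i) (+ (j₁ ∸ i)) (+ j₂) ⟩
    (e₁ - (+ (j₁ ∸ i) + + i)) + (e₂ - + j₂)
      ≡⟨ cong (λ n → (e₁ - n) + (e₂ - + j₂)) (sym (ℤP.pos-+ (j₁ ∸ i) i)) ⟩
    (e₁ - + ((j₁ ∸ i) ℕ.+ i)) + (e₂ - + j₂)
      ≡⟨ cong (λ n → (e₁ - + n) + (e₂ - + j₂)) (ℕP.m∸n+n≡m i≤j₁) ⟩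
    K ∎
    where
    regroup′ : ∀ e₁ e₂ i a j → e₁ + e₂ - i - (a + j) ≡ (e₁ - (a + i)) + (e₂ - j)
    regroup′ = solve-∀
  leibniz-term : ∀ i → i < suc j₁ →
    c₁ * c₂ * binom j₁ i * ff e₂ i * (ff s ((j₁ ∸ i) ℕ.+ j₂) * G (e₁ + e₂ - + i - + ((j₁ ∸ i) ℕ.+ j₂)))
      ≡ M * (+ (j₁ C i) * ff e₂ i * ff (s - + j₂) (j₁ ∸ i))
  leibniz-term i (s≤s i≤j₁) =
    trans (cong₂ (λ f g → c₁ * c₂ * binom j₁ i * ff e₂ i * (f * G g))
                 (ff-+ s (j₁ ∸ i) j₂) (offset i i≤j₁))
          (regroup″ c₁ c₂ (binom j₁ i) (ff e₂ i) (ff s j₂) (ff (s - + j₂) (j₁ ∸ i)) (G K))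
    where
    regroup″ : ∀ c₁ c₂ b f g h k → c₁ * c₂ * b * f * (g * h * k) ≡ c₁ * c₂ * g * k * (b * f * h)
    regroup″ = solve-∀

onPower-⊗ : ∀ s G A B →
  onPower s G (A ⊗ B) ≡ lin (λ e j → ff s j * onPower (s + (e - + j)) (λ k → G (k + (e - + j))) A) B
onPower-⊗ s G [] B = sym (lin-0ʷ (λ e j → ℤP.*-zeroʳ (ff s j)) B)
onPower-⊗ s G (t@(term c e j) ∷ A) B = begin
  onPower s G (concatMap (mulTerm t) B ++ A ⊗ B)
    ≡⟨ lin-++ _ (concatMap (mulTerm t) B) (A ⊗ B) ⟩
  onPower s G (concatMap (mulTerm t) B) + onPower s G (A ⊗ B)
    ≡⟨ cong₂ _+_ (row B) (onPower-⊗ s G A B) ⟩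
  lin (λ e′ j′ → ff s j′ * onPower′ e′ j′ (t ∷ [])) B
    + lin (λ e′ j′ → ff s j′ * onPower′ e′ j′ A) B
    ≡⟨ sym (lin-+ʷ _ _ B) ⟩
  lin (λ e′ j′ → ff s j′ * onPower′ e′ j′ (t ∷ []) + ff s j′ * onPower′ e′ j′ A) B
    ≡⟨ lin-cong (λ e′ j′ → distrib (ff s j′) (c * (ff (s + (e′ - + j′)) j * G (e - + j + (e′ - + j′))))
                                   (onPower′ e′ j′ A)) B ⟩
  lin (λ e′ j′ → ff s j′ * onPower′ e′ j′ (t ∷ A)) B ∎
  where
  open ≡-Reasoning
  onPower′ : ℤ → ℕ → Op → ℤ
  onPower′ e′ j′ = onPower (s + (e′ - + j′)) (λ k → G (k + (e′ - + j′)))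
  distrib : ∀ f x y → f * (x + + 0) + f * y ≡ f * (x + y)
  distrib = solve-∀
  row : ∀ B → onPower s G (concatMap (mulTerm t) B) ≡ lin (λ e′ j′ → ff s j′ * onPower′ e′ j′ (t ∷ [])) B
  row [] = refl
  row (term c′ e′ j′ ∷ B) =
    trans (lin-++ _ (mulTerm t (term c′ e′ j′)) (concatMap (mulTerm t) B))
          (cong₂ _+_ (onPower-mulTerm s G c e j c′ e′ j′) (row B))

entry-adjoint : ∀ s d A → entry s d (adjoint A) ≡ entry (- s - d - + 1) d A
entry-adjoint s d [] = refl
entry-adjoint s d (term c e j ∷ A) =
  trans (lin-++ _ (scale (c * (- + 1) ^ j) (DPow j ⊗ uPow e)) (adjoint A))
        (cong₂ _+_ transposed (entry-adjoint s d A))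
  where
  open ≡-Reasoning
  s′ = - s - d - + 1
  transposed : entry s d (scale (c * (- + 1) ^ j) (DPow j ⊗ uPow e)) ≡ c * (ff s′ j * δ d (e - + j))
  transposed = begin
    entry s d (scale (c * (- + 1) ^ j) (DPow j ⊗ uPow e))
      ≡⟨ lin-scale _ (c * (- + 1) ^ j) (DPow j ⊗ uPow e) ⟩
    c * (- + 1) ^ j * entry s d (DPow j ⊗ uPow e)
      ≡⟨ cong (c * (- + 1) ^ j *_) (onPower-⊗ s (δ d) (DPow j) (uPow e)) ⟩
    c * (- + 1) ^ j * (+ 1 * (+ 1 * (+ 1 * (ff (s + (e - + 0)) j * δ d (+ 0 - + j + (e - + 0))) + + 0)) + + 0)
      ≡⟨ cong₂ (λ x k → c * (- + 1) ^ j * (+ 1 * (+ 1 * (+ 1 * (ff x j * δ d k) + + 0)) + + 0))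
               (cong (_+_ s) (ℤP.+-identityʳ e)) (shift e (+ j)) ⟩
    c * (- + 1) ^ j * (+ 1 * (+ 1 * (+ 1 * (ff (s + e) j * δ d (e - + j)) + + 0)) + + 0)
      ≡⟨ regroup c ((- + 1) ^ j) (ff (s + e) j) (δ d (e - + j)) ⟩
    c * ((- + 1) ^ j * ff (s + e) j * δ d (e - + j))
      ≡⟨ cong (c *_) (*-δ-cong d (e - + j) reflected) ⟩
    c * (ff s′ j * δ d (e - + j)) ∎
    where
    shift : ∀ e j → + 0 - j + (e - + 0) ≡ e - j
    shift = solve-∀
    regroup : ∀ c p f x → c * p * (+ 1 * (+ 1 * (+ 1 * (f * x) + + 0)) + + 0) ≡ c * (p * f * x)
    regroup = solve-∀
    reflected : e - + j ≡ d → (- + 1) ^ j * ff (s + e) j ≡ ff s′ j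
    reflected refl = trans (ff-reflect (s + e) j) (cong (λ x → ff x j) (shift′ s e (+ j)))
      where
      shift′ : ∀ s e j → j - + 1 - (s + e) ≡ - s - (e - j) - + 1
      shift′ = solve-∀

lowest-weight : ∀ e j e′ j′ → j ≤ j′ →
  ff (+ j) j′ * δ (e - + j) (e′ - + j′) ≡ ff (+ j) j * unit e j e′ j′
lowest-weight e j e′ j′ j≤j′ with ℕP.m≤n⇒m<n∨m≡n j≤j′
... | inj₁ j<j′ rewrite ff-vanishes j<j′ =
  sym (trans (cong (λ b → ff (+ j) j * (if b then + 1 else + 0)) (hits-≢ (ℕP.<⇒≢ j<j′ ∘ λ (_ , q) → q)))
             (ℤP.*-zeroʳ (ff (+ j) j)))
... | inj₂ refl with e′ ℤ.≟ e
...   | yes refl =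
  trans (cong (ff (+ j) j *_) (δ-refl (e - + j)))
        (sym (cong (λ b → ff (+ j) j * (if b then + 1 else + 0)) (hits-refl e j)))
...   | no e′≢e =
  trans (cong (ff (+ j) j *_) (δ-≢ (e′≢e ∘ i-k≡j-k⇒i≡j e′ e (+ j))))
        (sym (cong (λ b → ff (+ j) j * (if b then + 1 else + 0)) (hits-≢ (e′≢e ∘ λ (p , _) → sym p))))

entry-lowest : ∀ X e j → (∀ e′ j′ → j′ < j → coeff X e′ j′ ≡ + 0) →
  entry (+ j) (e - + j) X ≡ ff (+ j) j * coeff X e j
entry-lowest X e j lower = begin
  lin w X                                          ≡⟨ lin-cong (λ e′ j′ → split (w e′ j′) (fu e′ j′)) X ⟩
  lin (λ e′ j′ → v e′ j′ + fu e′ j′) X              ≡⟨ lin-+ʷ v fu X ⟩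
  lin v X + lin fu X                                ≡⟨ cong₂ _+_ (lin-vanishes v X vanish)
                                                                  (lin-*ʷ (ff (+ j) j) (unit e j) X) ⟩
  + 0 + ff (+ j) j * lin (unit e j) X               ≡⟨ ℤP.+-identityˡ _ ⟩
  ff (+ j) j * lin (unit e j) X                     ≡⟨ cong (ff (+ j) j *_) (sym (coeff-as-lin X e j)) ⟩
  ff (+ j) j * coeff X e j                          ∎
  where
  open ≡-Reasoning
  w fu v : ℤ → ℕ → ℤ
  w e′ j′ = ff (+ j) j′ * δ (e - + j) (e′ - + j′)
  fu e′ j′ = ff (+ j) j * unit e j e′ j′
  v e′ j′ = w e′ j′ - fu e′ j′
  split : ∀ x y → x ≡ (x - y) + y
  split = solve-∀
  vanish : ∀ e′ j′ → v e′ j′ * coeff X e′ j′ ≡ + 0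
  vanish e′ j′ with j′ ℕ.<? j
  ... | yes j′<j = trans (cong (v e′ j′ *_) (lower e′ j′ j′<j)) (ℤP.*-zeroʳ (v e′ j′))
  ... | no j′≮j =
    cong (_* coeff X e′ j′)
         (trans (cong (_- fu e′ j′) (lowest-weight e j e′ j′ (ℕP.≮⇒≥ j′≮j))) (ℤP.+-inverseʳ (fu e′ j′)))

entries-vanish⇒coeffs-vanish : ∀ X → (∀ s d → entry s d X ≡ + 0) → ∀ e j → coeff X e j ≡ + 0
entries-vanish⇒coeffs-vanish X entries≡0 e j = <-rec (λ j → ∀ e → coeff X e j ≡ + 0) step j e
  where
  step : ∀ j → (∀ {j′} → j′ < j → ∀ e → coeff X e j′ ≡ + 0) → ∀ e → coeff X e j ≡ + 0
  step j lower e with ℤP.i*j≡0⇒i≡0∨j≡0 (ff (+ j) j)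
                        (trans (sym (entry-lowest X e j (λ e′ j′ j′<j → lower j′<j e′)))
                               (entries≡0 (+ j) (e - + j)))
  ... | inj₁ ff≡0 = ⊥-elim (ff-diag≢0 j ff≡0)
  ... | inj₂ coeff≡0 = coeff≡0

entries-determine : ∀ A B → (∀ s d → entry s d A ≡ entry s d B) → A ≈op B
entries-determine A B entries≡ e j = ℤP.i-j≡0⇒i≡j _ _ (begin
  coeff A e j - coeff B e j          ≡⟨ cong₂ _-_ (coeff-as-lin A e j) (coeff-as-lin B e j) ⟩
  lin (unit e j) A - lin (unit e j) B ≡⟨ sym (difference (unit e j) A B) ⟩
  lin (unit e j) X                    ≡⟨ sym (coeff-as-lin X e j) ⟩
  coeff X e j                         ≡⟨ entries-vanish⇒coeffs-vanish X X-entries≡0 e j ⟩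
  + 0                                 ∎)
  where
  open ≡-Reasoning
  X = A ⊕ scale (- + 1) B
  difference : ∀ w A B → lin w (A ⊕ scale (- + 1) B) ≡ lin w A - lin w B
  difference w A B =
    trans (lin-++ w A (scale (- + 1) B))
          (cong (_+_ (lin w A)) (trans (lin-scale w (- + 1) B) (ℤP.-1*i≡-i (lin w B))))
  X-entries≡0 : ∀ s d → entry s d X ≡ + 0
  X-entries≡0 s d =
    trans (difference _ A B) (trans (cong (_- entry s d B) (entries≡ s d)) (ℤP.+-inverseʳ (entry s d B)))

-- Homogeneous and symmetric operators

-- A u^s = g s · u^(s + d₀)
record Homogeneous (d₀ : ℤ) (g : ℤ → ℤ) (A : Op) : Set where
  constructor homogeneous
  field onPower≡ : ∀ s G → onPower s G A ≡ G d₀ * g s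
open Homogeneous

homogeneous-cong : ∀ {d d′ g g′ A} → d ≡ d′ → (∀ s → g s ≡ g′ s) →
  Homogeneous d g A → Homogeneous d′ g′ A
homogeneous-cong {d} refl g≗g′ hom = homogeneous λ s G → trans (onPower≡ hom s G) (cong (G d *_) (g≗g′ s))

homogeneous-monomial : ∀ c e → Homogeneous e (λ _ → c) (term c e 0 ∷ [])
homogeneous-monomial c e = homogeneous λ s G →
  trans (cong (λ k → c * (+ 1 * G k) + + 0) (ℤP.+-identityʳ e)) (regroup c (G e))
  where
  regroup : ∀ c g → c * (+ 1 * g) + + 0 ≡ g * c
  regroup = solve-∀

homogeneous-D : Homogeneous (- + 1) (λ s → s) Dop
homogeneous-D = homogeneous λ s G → regroup s (G (- + 1))
  where
  regroup : ∀ s g → + 1 * (+ 1 * (s - + 0) * g) + + 0 ≡ g * s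
  regroup = solve-∀

homogeneous-⊕ : ∀ {d g h A B} → Homogeneous d g A → Homogeneous d h B → Homogeneous d (λ s → g s + h s) (A ⊕ B)
homogeneous-⊕ {d} {g} {h} {A} {B} homA homB = homogeneous λ s G →
  trans (lin-++ _ A B) (trans (cong₂ _+_ (onPower≡ homA s G) (onPower≡ homB s G))
                              (sym (ℤP.*-distribˡ-+ (G d) (g s) (h s))))

homogeneous-scale : ∀ {d g A} a → Homogeneous d g A → Homogeneous d (λ s → a * g s) (scale a A)
homogeneous-scale {d} {g} {A} a hom = homogeneous λ s G →
  trans (lin-scale _ a A) (trans (cong (a *_) (onPower≡ hom s G)) (regroup a (G d) (g s)))
  where
  regroup : ∀ a x y → a * (x * y) ≡ x * (a * y)
  regroup = solve-∀

homogeneous-⊗ : ∀ {dA dB gA gB A B} → Homogeneous dA gA A → Homogeneous dB gB B →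
  Homogeneous (dA + dB) (λ s → gA (s + dB) * gB s) (A ⊗ B)
homogeneous-⊗ {dA} {dB} {gA} {gB} {A} {B} homA homB = homogeneous λ s G → begin
  onPower s G (A ⊗ B)
    ≡⟨ onPower-⊗ s G A B ⟩
  lin (λ e j → ff s j * onPower (s + (e - + j)) (λ k → G (k + (e - + j))) A) B
    ≡⟨ lin-cong (λ e j → cong (ff s j *_) (onPower≡ homA (s + (e - + j)) (λ k → G (k + (e - + j))))) B ⟩
  onPower s (λ k → G (dA + k) * gA (s + k)) B
    ≡⟨ onPower≡ homB s (λ k → G (dA + k) * gA (s + k)) ⟩
  G (dA + dB) * gA (s + dB) * gB s
    ≡⟨ ℤP.*-assoc (G (dA + dB)) _ _ ⟩
  G (dA + dB) * (gA (s + dB) * gB s) ∎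
  where open ≡-Reasoning

homogeneous-⊗₀ : ∀ {d g h A B} → Homogeneous d g A → Homogeneous (+ 0) h B →
  Homogeneous d (λ s → g s * h s) (A ⊗ B)
homogeneous-⊗₀ {d} {g} {h} homA homB =
  homogeneous-cong (ℤP.+-identityʳ d) (λ s → cong (λ x → g x * h s) (ℤP.+-identityʳ s)) (homogeneous-⊗ homA homB)

homogeneous-pow : ∀ {g A} → Homogeneous (+ 0) g A → ∀ n → Homogeneous (+ 0) (λ s → g s ^ n) (pow A n)
homogeneous-pow hom zero = homogeneous-monomial (+ 1) (+ 0)
homogeneous-pow hom (suc n) = homogeneous-⊗₀ hom (homogeneous-pow hom n)

homogeneous-sumOps : ∀ {X : Set} {d} (F : X → Op) (g : X → ℤ → ℤ) {xs} →
  All (λ x → Homogeneous d (g x) (F x)) xs → Homogeneous d (λ s → ∑ xs (λ x → g x s)) (sumOps (map F xs))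
homogeneous-sumOps {d = d} F g [] = homogeneous λ s G → sym (ℤP.*-zeroʳ (G d))
homogeneous-sumOps F g (hom ∷ homs) = homogeneous-⊕ hom (homogeneous-sumOps F g homs)

homogeneous-ϑ̂ : Homogeneous (+ 0) (λ s → s + + 1) ϑ̂
homogeneous-ϑ̂ = homogeneous-cong refl (λ s → ℤP.*-identityʳ (s + + 1))
                  (homogeneous-⊗ homogeneous-D (homogeneous-monomial (+ 1) (+ 1)))

homogeneous-ϑ̂+ : ∀ r → Homogeneous (+ 0) (λ s → s + + 1 + r) (ϑ̂+ r)
homogeneous-ϑ̂+ r = homogeneous-⊕ homogeneous-ϑ̂ (homogeneous-monomial r (+ 0))

record Symmetric (ε : ℤ) (A : Op) : Set where
  constructor symmetric
  field entry-reflect : ∀ s d → entry (- s - d - + 1) d A ≡ ε * entry s d A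
open Symmetric

symmetric⇒adjoint≈op : ∀ {ε A} → Symmetric ε A → adjoint A ≈op scale ε A
symmetric⇒adjoint≈op {ε} {A} sym-A = entries-determine (adjoint A) (scale ε A) λ s d →
  trans (entry-adjoint s d A) (trans (entry-reflect sym-A s d) (sym (lin-scale _ ε A)))

symmetric-[] : ∀ ε → Symmetric ε []
symmetric-[] ε = symmetric λ _ _ → sym (ℤP.*-zeroʳ ε)

symmetric-⊕ : ∀ {ε A B} → Symmetric ε A → Symmetric ε B → Symmetric ε (A ⊕ B)
symmetric-⊕ {ε} {A} {B} sym-A sym-B = symmetric λ s d → begin
  entry (- s - d - + 1) d (A ⊕ B)
    ≡⟨ lin-++ _ A B ⟩
  entry (- s - d - + 1) d A + entry (- s - d - + 1) d B
    ≡⟨ cong₂ _+_ (entry-reflect sym-A s d) (entry-reflect sym-B s d) ⟩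
  ε * entry s d A + ε * entry s d B
    ≡⟨ sym (ℤP.*-distribˡ-+ ε _ _) ⟩
  ε * (entry s d A + entry s d B)
    ≡⟨ cong (ε *_) (sym (lin-++ _ A B)) ⟩
  ε * entry s d (A ⊕ B) ∎
  where open ≡-Reasoning

homogeneous⇒symmetric : ∀ {ε d₀ g A} → Homogeneous d₀ g A → (∀ s → g (- s - d₀ - + 1) ≡ ε * g s) →
  Symmetric ε A
homogeneous⇒symmetric {ε} {d₀} {g} {A} hom g-reflect = symmetric λ s d → begin
  entry (- s - d - + 1) d A     ≡⟨ onPower≡ hom (- s - d - + 1) (δ d) ⟩
  δ d d₀ * g (- s - d - + 1)    ≡⟨ ℤP.*-comm (δ d d₀) _ ⟩
  g (- s - d - + 1) * δ d d₀    ≡⟨ *-δ-cong {g (- s - d - + 1)} d d₀ (λ { refl → g-reflect s }) ⟩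
  ε * g s * δ d d₀              ≡⟨ regroup ε (g s) (δ d d₀) ⟩
  ε * (δ d d₀ * g s)            ≡⟨ cong (ε *_) (sym (onPower≡ hom s (δ d))) ⟩
  ε * entry s d A               ∎
  where
  open ≡-Reasoning
  regroup : ∀ e x y → e * x * y ≡ e * (y * x)
  regroup = solve-∀

leading-symmetric : ∀ m → Symmetric ((- + 1) ^ m) (uPow (+ 1) ⊗ pow ϑ̂ m)
leading-symmetric m = homogeneous⇒symmetric homogeneous-leading λ s →
  trans (cong (_^ m) (negate s)) (^-distrib-* (- + 1) (s + + 1) m)
  where
  homogeneous-leading : Homogeneous (+ 1) (λ s → (s + + 1) ^ m) (uPow (+ 1) ⊗ pow ϑ̂ m)
  homogeneous-leading = homogeneous-cong refl (λ s → ℤP.*-identityˡ _)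
    (homogeneous-⊗₀ (homogeneous-monomial (+ 1) (+ 1)) (homogeneous-pow homogeneous-ϑ̂ m))
  negate : ∀ s → - s - + 1 - + 1 + + 1 ≡ (- + 1) * (s + + 1)
  negate = solve-∀

-- Chains of tuples and their mirror images

pairs : {X : Set} → List X → List (X × X)
pairs (a ∷ b ∷ xs) = (a , b) ∷ pairs (b ∷ xs)
pairs _ = []

pairs-map : ∀ {X Y : Set} (f : X → Y) xs → pairs (map f xs) ≡ map (Product.map f f) (pairs xs)
pairs-map f [] = refl
pairs-map f (a ∷ []) = refl
pairs-map f (a ∷ b ∷ xs) = cong ((f a , f b) ∷_) (pairs-map f (b ∷ xs))

pairs-∷ʳ : ∀ {X : Set} xs (y z : X) → pairs ((xs ∷ʳ y) ∷ʳ z) ≡ pairs (xs ∷ʳ y) ∷ʳ (y , z)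
pairs-∷ʳ [] y z = refl
pairs-∷ʳ (a ∷ []) y z = refl
pairs-∷ʳ (a ∷ b ∷ xs) y z = cong ((a , b) ∷_) (pairs-∷ʳ (b ∷ xs) y z)

pairs-reverse : ∀ {X : Set} (xs : List X) → pairs (reverse xs) ≡ reverse (map swap (pairs xs))
pairs-reverse [] = refl
pairs-reverse (a ∷ []) = refl
pairs-reverse (a ∷ b ∷ xs) = begin
  pairs (reverse (a ∷ b ∷ xs))
    ≡⟨ cong pairs (ListP.unfold-reverse a (b ∷ xs)) ⟩
  pairs (reverse (b ∷ xs) ∷ʳ a)
    ≡⟨ cong (λ ys → pairs (ys ∷ʳ a)) (ListP.unfold-reverse b xs) ⟩
  pairs ((reverse xs ∷ʳ b) ∷ʳ a)
    ≡⟨ pairs-∷ʳ (reverse xs) b a ⟩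
  pairs (reverse xs ∷ʳ b) ∷ʳ (b , a)
    ≡⟨ cong (λ ys → pairs ys ∷ʳ (b , a)) (sym (ListP.unfold-reverse b xs)) ⟩
  pairs (reverse (b ∷ xs)) ∷ʳ (b , a)
    ≡⟨ cong (_∷ʳ (b , a)) (pairs-reverse (b ∷ xs)) ⟩
  reverse (map swap (pairs (b ∷ xs))) ∷ʳ (b , a)
    ≡⟨ sym (ListP.unfold-reverse (b , a) (map swap (pairs (b ∷ xs)))) ⟩
  reverse (map swap (pairs (a ∷ b ∷ xs))) ∎
  where open ≡-Reasoning

pairs-All : ∀ {X : Set} {P : X → Set} {xs} → All P xs → All (λ (a , b) → P a × P b) (pairs xs)
pairs-All [] = []
pairs-All (_ ∷ []) = []
pairs-All (pa ∷ pb ∷ ps) = (pa , pb) ∷ pairs-All (pb ∷ ps)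

length-pairs : ∀ {X : Set} (x : X) xs → length (pairs (x ∷ xs)) ≡ length xs
length-pairs x [] = refl
length-pairs x (y ∷ xs) = cong suc (length-pairs y xs)

map-pairs-reverse-map : ∀ {X Y Z : Set} (f : Y × Y → Z) (g : X → Y) xs →
  map f (pairs (reverse (map g xs))) ≡ reverse (map (λ (a , b) → f (g b , g a)) (pairs xs))
map-pairs-reverse-map f g xs = begin
  map f (pairs (reverse (map g xs)))
    ≡⟨ cong (map f) (pairs-reverse (map g xs)) ⟩
  map f (reverse (map swap (pairs (map g xs))))
    ≡⟨ ListP.reverse-map f (map swap (pairs (map g xs))) ⟩
  reverse (map f (map swap (pairs (map g xs))))
    ≡⟨ cong (λ ps → reverse (map f (map swap ps))) (pairs-map g xs) ⟩
  reverse (map f (map swap (map (Product.map g g) (pairs xs))))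
    ≡⟨ cong reverse (sym (trans (ListP.map-∘ (pairs xs)) (ListP.map-∘ _))) ⟩
  reverse (map (λ (a , b) → f (g b , g a)) (pairs xs)) ∎
  where open ≡-Reasoning

diffs : List ℕ → List ℕ
diffs xs = map (uncurry _∸_) (pairs xs)

NonIncreasing : List ℕ → Set
NonIncreasing xs = All (λ (a , b) → b ≤ a) (pairs xs)

telescope : ∀ t xs b → NonIncreasing (t ∷ xs ∷ʳ b) → sum (diffs (t ∷ xs ∷ʳ b)) ℕ.+ b ≡ t
telescope t [] b (b≤t ∷ []) = trans (cong (ℕ._+ b) (ℕP.+-identityʳ (t ∸ b))) (ℕP.m∸n+n≡m b≤t)
telescope t (x ∷ xs) b (x≤t ∷ desc) =
  trans (ℕP.+-assoc (t ∸ x) _ b) (trans (cong ((t ∸ x) ℕ.+_) (telescope x xs b desc)) (ℕP.m∸n+n≡m x≤t))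

∸-mirror : ∀ {N a b} → b ≤ a → a ≤ N → N ∸ b ≡ (N ∸ a) ℕ.+ (a ∸ b)
∸-mirror {N} {a} {b} b≤a a≤N = trans (cong (_∸ b) (sym (ℕP.m∸n+n≡m a≤N))) (ℕP.+-∸-assoc (N ∸ a) b≤a)

diffs-mirror : ∀ N xs → All (_≤ N) xs → NonIncreasing xs → diffs (reverse (map (N ∸_) xs)) ≡ reverse (diffs xs)
diffs-mirror N xs bounded desc =
  trans (map-pairs-reverse-map (uncurry _∸_) (N ∸_) xs)
        (cong reverse (ListP.map-cong-local (All.zipWith mirrored (pairs-All bounded , desc))))
  where
  mirrored : ∀ {(a , b) : ℕ × ℕ} → (a ≤ N × b ≤ N) × b ≤ a → (N ∸ b) ∸ (N ∸ a) ≡ a ∸ b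
  mirrored {a , b} ((a≤N , _) , b≤a) =
    trans (cong (_∸ (N ∸ a)) (∸-mirror b≤a a≤N)) (ℕP.m+n∸m≡n (N ∸ a) (a ∸ b))

gapOK : ℕ × ℕ → Bool
gapOK (a , b) = b ℕ.+ 2 ≤ᵇ a

gapChain-pairs : ∀ xs → gapChain xs ≡ and (map gapOK (pairs xs))
gapChain-pairs [] = refl
gapChain-pairs (a ∷ []) = refl
gapChain-pairs (a ∷ b ∷ xs) = cong (gapOK (a , b) ∧_) (gapChain-pairs (b ∷ xs))

and-++ : ∀ xs ys → and (xs ++ ys) ≡ and xs ∧ and ys
and-++ [] ys = refl
and-++ (x ∷ xs) ys = trans (cong (x ∧_) (and-++ xs ys)) (sym (BoolP.∧-assoc x (and xs) (and ys)))

and-reverse : ∀ xs → and (reverse xs) ≡ and xs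
and-reverse [] = refl
and-reverse (x ∷ xs) = begin
  and (reverse (x ∷ xs))   ≡⟨ cong and (ListP.unfold-reverse x xs) ⟩
  and (reverse xs ∷ʳ x)    ≡⟨ and-++ (reverse xs) (x ∷ []) ⟩
  and (reverse xs) ∧ x ∧ true ≡⟨ cong₂ (λ a b → a ∧ b) (and-reverse xs) (BoolP.∧-identityʳ x) ⟩
  and xs ∧ x               ≡⟨ BoolP.∧-comm (and xs) x ⟩
  x ∧ and xs               ∎
  where open ≡-Reasoning

gap-mirror : ∀ {N a b} → b ℕ.+ 2 ≤ a → a ≤ N → (N ∸ a) ℕ.+ 2 ≤ N ∸ b
gap-mirror {N} {a} {b} gap a≤N = begin
  (N ∸ a) ℕ.+ 2          ≤⟨ ℕP.+-monoʳ-≤ (N ∸ a) two≤a∸b ⟩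
  (N ∸ a) ℕ.+ (a ∸ b)    ≡⟨ sym (∸-mirror (ℕP.m+n≤o⇒m≤o b gap) a≤N) ⟩
  N ∸ b                  ∎
  where
  open ℕP.≤-Reasoning
  two≤a∸b : 2 ≤ a ∸ b
  two≤a∸b = subst (_≤ a ∸ b) (ℕP.m+n∸m≡n b 2) (ℕP.∸-monoˡ-≤ b gap)

gapOK-mirror : ∀ {N a b} → a ≤ N → b ≤ N → gapOK (N ∸ b , N ∸ a) ≡ gapOK (a , b)
gapOK-mirror {N} {a} {b} a≤N b≤N = does-⇔ (mk⇔ unmirror (λ gap → gap-mirror gap a≤N)) (_ ℕ.≤? _) (_ ℕ.≤? _)
  where
  unmirror : (N ∸ a) ℕ.+ 2 ≤ N ∸ b → b ℕ.+ 2 ≤ a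
  unmirror gap = subst₂ (λ x y → x ℕ.+ 2 ≤ y) (ℕP.m∸[m∸n]≡n b≤N) (ℕP.m∸[m∸n]≡n a≤N)
                        (gap-mirror gap (ℕP.m∸n≤m N b))

Tuple : ℕ → List ℕ → Set
Tuple m α = All (λ a → 1 ≤ a × a ≤ suc m) α

m+1≤m+2 : ∀ m → suc m ≤ m ℕ.+ 2
m+1≤m+2 m = ℕP.≤-trans (ℕP.n≤1+n (suc m)) (ℕP.≤-reflexive (ℕP.+-comm 2 m))

tuple-bounded : ∀ {m α} → Tuple m α → All (_≤ m ℕ.+ 2) α
tuple-bounded {m} = All.map λ (_ , a≤m+1) → ℕP.≤-trans a≤m+1 (m+1≤m+2 m)

tuple-head : ∀ {m α} → Tuple m α → Maybe.All (_≤ suc m) (head α)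
tuple-head [] = Maybe.nothing
tuple-head ((_ , a≤m+1) ∷ _) = just a≤m+1

chain : ℕ → List ℕ → List ℕ
chain m α = suc m ∷ α ++ 1 ∷ []

mirror : ℕ → List ℕ → List ℕ
mirror m α = reverse (map (m ℕ.+ 2 ∸_) α)

chain-mirror : ∀ m α → chain m (mirror m α) ≡ reverse (map (m ℕ.+ 2 ∸_) (chain m α))
chain-mirror m α = sym (begin
  reverse (ρ (suc m) ∷ map ρ (α ++ 1 ∷ []))
    ≡⟨ cong (λ xs → reverse (ρ (suc m) ∷ xs)) (ListP.map-++ ρ α (1 ∷ [])) ⟩
  reverse (ρ (suc m) ∷ (map ρ α ∷ʳ ρ 1))
    ≡⟨ ListP.unfold-reverse (ρ (suc m)) (map ρ α ∷ʳ ρ 1) ⟩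
  reverse (map ρ α ∷ʳ ρ 1) ∷ʳ ρ (suc m)
    ≡⟨ cong (_∷ʳ ρ (suc m)) (ListP.reverse-++ (map ρ α) (ρ 1 ∷ [])) ⟩
  (ρ 1 ∷ mirror m α) ∷ʳ ρ (suc m)
    ≡⟨ cong₂ (λ x y → (x ∷ mirror m α) ∷ʳ y) (ρ-1 m) (ρ-suc m) ⟩
  chain m (mirror m α) ∎)
  where
  open ≡-Reasoning
  ρ = m ℕ.+ 2 ∸_
  ρ-1 : ∀ m → m ℕ.+ 2 ∸ 1 ≡ suc m
  ρ-1 m = cong (_∸ 1) (ℕP.+-comm m 2)
  ρ-suc : ∀ m → m ℕ.+ 2 ∸ suc m ≡ 1
  ρ-suc m = trans (cong (_∸ suc m) (ℕP.+-comm m 2)) (ℕP.m+n∸n≡m 1 (suc m))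

gapChain-mirror : ∀ m α → All (_≤ m ℕ.+ 2) α → gapChain (mirror m α) ≡ gapChain α
gapChain-mirror m α bounded = begin
  gapChain (mirror m α)                                         ≡⟨ gapChain-pairs (mirror m α) ⟩
  and (map gapOK (pairs (mirror m α)))                          ≡⟨ cong and (map-pairs-reverse-map gapOK ρ α) ⟩
  and (reverse (map gapOK′ (pairs α)))                          ≡⟨ and-reverse (map gapOK′ (pairs α)) ⟩
  and (map gapOK′ (pairs α))
    ≡⟨ cong and (ListP.map-cong-local (All.map mirrored (pairs-All bounded))) ⟩
  and (map gapOK (pairs α))                                     ≡⟨ sym (gapChain-pairs α) ⟩
  gapChain α                                                    ∎
  where
  open ≡-Reasoning
  ρ = m ℕ.+ 2 ∸_
  gapOK′ : ℕ × ℕ → Bool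
  gapOK′ (a , b) = gapOK (ρ b , ρ a)
  mirrored : ∀ {(a , b) : ℕ × ℕ} → a ≤ m ℕ.+ 2 × b ≤ m ℕ.+ 2 → gapOK′ (a , b) ≡ gapOK (a , b)
  mirrored (a≤N , b≤N) = gapOK-mirror a≤N b≤N

descending : ∀ t α → 1 ≤ t → All (1 ≤_) α → gapChain α ≡ true → Maybe.All (_≤ t) (head α) →
  NonIncreasing (t ∷ α ∷ʳ 1)
descending t [] 1≤t _ _ _ = 1≤t ∷ []
descending t (a ∷ []) _ (1≤a ∷ []) _ (just a≤t) = a≤t ∷ 1≤a ∷ []
descending t (a ∷ b ∷ α) _ (1≤a ∷ 1≤α) gaps (just a≤t) with b ℕ.+ 2 ≤ᵇ a in gap
... | true = a≤t ∷ descending a (b ∷ α) 1≤a 1≤α gaps (just b≤a)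
  where
  b≤a : b ≤ a
  b≤a = ℕP.m+n≤o⇒m≤o b (ℕP.≤ᵇ⇒≤ (b ℕ.+ 2) a (subst T (sym gap) tt))
... | false with () ← gaps

chain-descending : ∀ {m α} → Tuple m α → gapChain α ≡ true → NonIncreasing (chain m α)
chain-descending {m} {α} tuple gaps = descending (suc m) α (s≤s z≤n) (All.map proj₁ tuple) gaps (tuple-head tuple)

chain-bounded : ∀ {m α} → Tuple m α → All (_≤ m ℕ.+ 2) (chain m α)
chain-bounded {m} tuple = m+1≤m+2 m ∷ AllP.∷ʳ⁺ (tuple-bounded tuple) (ℕP.≤-trans (s≤s z≤n) (m+1≤m+2 m))

sum-diffs-chain : ∀ {m α} → Tuple m α → gapChain α ≡ true → sum (diffs (chain m α)) ≡ m
sum-diffs-chain {m} {α} tuple gaps =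
  ℕP.+-cancelʳ-≡ 1 _ _ (trans (telescope (suc m) α 1 (chain-descending tuple gaps)) (ℕP.+-comm 1 m))

length-diffs-chain : ∀ m α → length (diffs (chain m α)) ≡ length α ℕ.+ 1
length-diffs-chain m α =
  trans (ListP.length-map (uncurry _∸_) (pairs (chain m α))) (trans (length-pairs (suc m) (α ∷ʳ 1)) (ListP.length-++ α))

coefficient : ℕ → ℕ → ℤ
coefficient m a = + a * (+ a - + (m ℕ.+ 2))

weight : ℕ → List ℕ → ℤ
weight m [] = + 1
weight m (a ∷ α) = coefficient m a * weight m α

weight-++ : ∀ m xs ys → weight m (xs ++ ys) ≡ weight m xs * weight m ys
weight-++ m [] ys = sym (ℤP.*-identityˡ (weight m ys))
weight-++ m (x ∷ xs) ys =
  trans (cong (coefficient m x *_) (weight-++ m xs ys)) (sym (ℤP.*-assoc (coefficient m x) (weight m xs) (weight m ys)))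

weight-reverse : ∀ m xs → weight m (reverse xs) ≡ weight m xs
weight-reverse m [] = refl
weight-reverse m (x ∷ xs) = begin
  weight m (reverse (x ∷ xs))              ≡⟨ cong (weight m) (ListP.unfold-reverse x xs) ⟩
  weight m (reverse xs ∷ʳ x)               ≡⟨ weight-++ m (reverse xs) (x ∷ []) ⟩
  weight m (reverse xs) * weight m (x ∷ []) ≡⟨ cong₂ _*_ (weight-reverse m xs) (ℤP.*-identityʳ _) ⟩
  weight m xs * coefficient m x            ≡⟨ ℤP.*-comm (weight m xs) (coefficient m x) ⟩
  weight m (x ∷ xs)                        ∎
  where open ≡-Reasoning

weight-mirror : ∀ m α → All (_≤ m ℕ.+ 2) α → weight m (mirror m α) ≡ weight m α
weight-mirror m α bounded = trans (weight-reverse m (map (m ℕ.+ 2 ∸_) α)) (go α bounded)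
  where
  go : ∀ α → All (_≤ m ℕ.+ 2) α → weight m (map (m ℕ.+ 2 ∸_) α) ≡ weight m α
  go [] [] = refl
  go (a ∷ α) (a≤N ∷ bounded) = cong₂ _*_ coefficient-mirror (go α bounded)
    where
    N = m ℕ.+ 2
    coefficient-mirror : coefficient m (N ∸ a) ≡ coefficient m a
    coefficient-mirror = trans (cong (λ x → x * (x - + N)) (sym (trans (ℤP.m-n≡m⊖n N a) (ℤP.⊖-≥ a≤N))))
                        (reflect (+ N) (+ a))
      where
      reflect : ∀ n a → (n - a) * (n - a - n) ≡ a * (a - n)
      reflect = solve-∀

-- Symbols of the summands of L̃ₘ

risingProduct : ℤ → List ℕ → ℤ
risingProduct x [] = + 1
risingProduct x (e ∷ es) = x ^ e * risingProduct (x + + 1) es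

risingProduct-++ : ∀ x xs ys → risingProduct x (xs ++ ys) ≡ risingProduct x xs * risingProduct (x + + length xs) ys
risingProduct-++ x [] ys = trans (cong (λ y → risingProduct y ys) (sym (ℤP.+-identityʳ x))) (sym (ℤP.*-identityˡ _))
risingProduct-++ x (e ∷ es) ys = begin
  x ^ e * risingProduct (x + + 1) (es ++ ys)
    ≡⟨ cong (x ^ e *_) (risingProduct-++ (x + + 1) es ys) ⟩
  x ^ e * (risingProduct (x + + 1) es * risingProduct (x + + 1 + + length es) ys)
    ≡⟨ cong (λ y → x ^ e * (risingProduct (x + + 1) es * risingProduct y ys)) (ℤP.+-assoc x (+ 1) (+ length es)) ⟩
  x ^ e * (risingProduct (x + + 1) es * risingProduct (x + + suc (length es)) ys)
    ≡⟨ sym (ℤP.*-assoc (x ^ e) _ _) ⟩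
  x ^ e * risingProduct (x + + 1) es * risingProduct (x + + suc (length es)) ys ∎
  where open ≡-Reasoning

risingProduct-∷ʳ : ∀ x xs e → risingProduct x (xs ∷ʳ e) ≡ risingProduct x xs * (x + + length xs) ^ e
risingProduct-∷ʳ x xs e = trans (risingProduct-++ x xs (e ∷ [])) (cong (risingProduct x xs *_) (ℤP.*-identityʳ _))

risingProduct-reflect : ∀ x es →
  risingProduct (- x) es ≡ (- + 1) ^ sum es * risingProduct (x + + 1 - + length es) (reverse es)
risingProduct-reflect x [] = refl
risingProduct-reflect x (e ∷ es) = begin
  (- x) ^ e * risingProduct (- x + + 1) es
    ≡⟨ cong₂ (λ y z → y ^ e * risingProduct z es) (negate x) (neg-shift x) ⟩
  ((- + 1) * x) ^ e * risingProduct (- (x - + 1)) es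
    ≡⟨ cong₂ _*_ (^-distrib-* (- + 1) x e) (risingProduct-reflect (x - + 1) es) ⟩
  (- + 1) ^ e * x ^ e * ((- + 1) ^ sum es * risingProduct (x - + 1 + + 1 - + L) (reverse es))
    ≡⟨ cong (λ y → (- + 1) ^ e * x ^ e * ((- + 1) ^ sum es * risingProduct y (reverse es))) (start x (+ L)) ⟩
  (- + 1) ^ e * x ^ e * ((- + 1) ^ sum es * P)
    ≡⟨ regroup ((- + 1) ^ e) (x ^ e) ((- + 1) ^ sum es) P ⟩
  (- + 1) ^ e * (- + 1) ^ sum es * (P * x ^ e)
    ≡⟨ cong₂ _*_ (sym (ℤP.^-distribˡ-+-* (- + 1) e (sum es))) (cong (λ y → P * y ^ e) (sym end)) ⟩
  (- + 1) ^ (e ℕ.+ sum es) * (P * (x - + L + + length (reverse es)) ^ e)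
    ≡⟨ cong ((- + 1) ^ (e ℕ.+ sum es) *_) (sym (risingProduct-∷ʳ (x - + L) (reverse es) e)) ⟩
  (- + 1) ^ (e ℕ.+ sum es) * risingProduct (x - + L) (reverse es ∷ʳ e)
    ≡⟨ cong₂ (λ y z → (- + 1) ^ (e ℕ.+ sum es) * risingProduct y z)
             (start′ x (+ L)) (sym (ListP.unfold-reverse e es)) ⟩
  (- + 1) ^ (e ℕ.+ sum es) * risingProduct (x + + 1 - + suc L) (reverse (e ∷ es)) ∎
  where
  open ≡-Reasoning
  L = length es
  P = risingProduct (x - + L) (reverse es)
  negate : ∀ x → - x ≡ (- + 1) * x
  negate = solve-∀
  neg-shift : ∀ x → - x + + 1 ≡ - (x - + 1)
  neg-shift = solve-∀
  start : ∀ x l → x - + 1 + + 1 - l ≡ x - l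
  start = solve-∀
  start′ : ∀ x l → x - l ≡ x + + 1 - (+ 1 + l)
  start′ = solve-∀
  regroup : ∀ a b c d → a * b * (c * d) ≡ a * c * (d * b)
  regroup = solve-∀
  cancel : ∀ x l → x - l + l ≡ x
  cancel = solve-∀
  end : x - + L + + length (reverse es) ≡ x
  end = trans (cong (λ l → x - + L + + l) (ListP.length-reverse es)) (cancel x (+ L))

summandSymbol : ℕ → ℕ → List ℕ → ℤ → ℤ
summandSymbol m k α s = weight m α * risingProduct (s + + 1 - + k) (diffs (chain m α))

rising-step : ∀ {c w F B D} r e →
  Homogeneous (+ 0) (λ s → c * (s + + 1 + r) ^ e) F →
  Homogeneous (+ 0) (λ s → w * risingProduct (s + + 1 + r + + 1) D) B →
  Homogeneous (+ 0) (λ s → c * w * risingProduct (s + + 1 + r) (e ∷ D)) (F ⊗ B)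
rising-step {c} {w} {D = D} r e homF homB =
  homogeneous-cong refl (λ s → regroup c w ((s + + 1 + r) ^ e) (risingProduct (s + + 1 + r + + 1) D))
                   (homogeneous-⊗₀ homF homB)
  where
  regroup : ∀ c w p q → c * p * (w * q) ≡ c * w * (p * q)
  regroup = solve-∀

prodPartSymbol : ℕ → ℕ → ℕ → List ℕ → ℤ → ℤ
prodPartSymbol m k n α s = weight m α * risingProduct (s + + 1 + (+ n - + k)) (diffs (α ++ 1 ∷ []))

homogeneous-prodPart-∷ : ∀ m k n a e β {B} → Homogeneous (+ 0) (prodPartSymbol m k (suc n) β) B →
  Homogeneous (+ 0) (λ s → weight m (a ∷ β) * risingProduct (s + + 1 + (+ n - + k)) (e ∷ diffs (β ++ 1 ∷ [])))
              (scale (coefficient m a) (pow (ϑ̂+ (+ n - + k)) e) ⊗ B)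
homogeneous-prodPart-∷ m k n a e β homB =
  rising-step {coefficient m a} {weight m β} {D = D} (+ n - + k) e
    (homogeneous-scale (coefficient m a) (homogeneous-pow (homogeneous-ϑ̂+ (+ n - + k)) e))
    (homogeneous-cong refl (λ s → cong (λ x → weight m β * risingProduct x D) (shift s (+ n) (+ k))) homB)
  where
  D = diffs (β ++ 1 ∷ [])
  shift : ∀ s n k → s + + 1 + (+ 1 + n - k) ≡ s + + 1 + (n - k) + + 1
  shift = solve-∀

homogeneous-prodPart : ∀ m k n α → Homogeneous (+ 0) (prodPartSymbol m k n α) (prodPart m k n α)
homogeneous-prodPart m k n [] = homogeneous-monomial (+ 1) (+ 0)
homogeneous-prodPart m k n (a ∷ []) =
  homogeneous-prodPart-∷ m k n a (a ∸ 1) [] (homogeneous-prodPart m k (suc n) [])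
homogeneous-prodPart m k n (a ∷ b ∷ α) =
  homogeneous-prodPart-∷ m k n a (a ∸ b) (b ∷ α) (homogeneous-prodPart m k (suc n) (b ∷ α))

homogeneous-summand : ∀ m k a α → Homogeneous (+ 0) (summandSymbol m k (a ∷ α)) (summand m k (a ∷ α))
homogeneous-summand m k a α =
  homogeneous-cong refl (λ s → cong (_* risingProduct (s + + 1 - + k) (diffs (chain m (a ∷ α))))
                                    (ℤP.*-identityˡ (weight m (a ∷ α))))
    (rising-step {+ 1} {weight m (a ∷ α)} {D = D} (- + k) (suc m ∸ a)
      (homogeneous-cong refl (λ s → sym (ℤP.*-identityˡ _)) (homogeneous-pow (homogeneous-ϑ̂+ (- + k)) (suc m ∸ a)))
      (homogeneous-cong refl (λ s → cong (λ x → weight m (a ∷ α) * risingProduct x D) (shift s (+ k)))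
        (homogeneous-prodPart m k 1 (a ∷ α))))
  where
  D = diffs (a ∷ α ++ 1 ∷ [])
  shift : ∀ s k → s + + 1 + (+ 1 - k) ≡ s + + 1 + - k + + 1
  shift = solve-∀

summandSymbol-mirror : ∀ m k s α → Tuple m α → length α ≡ suc k → gapChain α ≡ true →
  summandSymbol m (suc k) α (+ k - + 1 - s) ≡ (- + 1) ^ m * summandSymbol m (suc k) (mirror m α) s
summandSymbol-mirror m k s α tuple |α| gaps = begin
  weight m α * risingProduct (+ k - + 1 - s + + 1 - + suc k) E
    ≡⟨ cong (λ x → weight m α * risingProduct x E) (negate (+ k) s) ⟩
  weight m α * risingProduct (- (s + + 1)) E
    ≡⟨ cong (weight m α *_) (risingProduct-reflect (s + + 1) E) ⟩
  weight m α * ((- + 1) ^ sum E * risingProduct (s + + 1 + + 1 - + length E) (reverse E))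
    ≡⟨ cong₂ (λ n x → weight m α * ((- + 1) ^ n * risingProduct x (reverse E))) (sum-diffs-chain tuple gaps) start ⟩
  weight m α * ((- + 1) ^ m * risingProduct (s + + 1 - + suc k) (reverse E))
    ≡⟨ cong (λ es → weight m α * ((- + 1) ^ m * risingProduct (s + + 1 - + suc k) es)) reversed ⟩
  weight m α * ((- + 1) ^ m * risingProduct (s + + 1 - + suc k) (diffs (chain m (mirror m α))))
    ≡⟨ cong (_* ((- + 1) ^ m * R)) (sym (weight-mirror m α (tuple-bounded tuple))) ⟩
  weight m (mirror m α) * ((- + 1) ^ m * risingProduct (s + + 1 - + suc k) (diffs (chain m (mirror m α))))
    ≡⟨ regroup (weight m (mirror m α)) ((- + 1) ^ m) R ⟩
  (- + 1) ^ m * summandSymbol m (suc k) (mirror m α) s ∎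
  where
  open ≡-Reasoning
  E = diffs (chain m α)
  R = risingProduct (s + + 1 - + suc k) (diffs (chain m (mirror m α)))
  negate : ∀ k s → k - + 1 - s + + 1 - (+ 1 + k) ≡ - (s + + 1)
  negate = solve-∀
  regroup : ∀ w ε r → w * (ε * r) ≡ ε * (w * r)
  regroup = solve-∀
  start : s + + 1 + + 1 - + length E ≡ s + + 1 - + suc k
  start = trans (cong (λ n → s + + 1 + + 1 - + n) (trans (length-diffs-chain m α) (cong (ℕ._+ 1) |α|)))
                (shift s (+ k))
    where
    shift : ∀ s k → s + + 1 + + 1 - (+ 1 + k + + 1) ≡ s + + 1 - (+ 1 + k)
    shift = solve-∀
  reversed : reverse E ≡ diffs (chain m (mirror m α))
  reversed = sym (trans (cong diffs (chain-mirror m α))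
                        (diffs-mirror (m ℕ.+ 2) (chain m α) (chain-bounded tuple) (chain-descending tuple gaps)))

-- Sums over admissible tuples

∑-allLists-suc : ∀ k vs G → ∑ (allLists (suc k) vs) G ≡ ∑ vs (λ a → ∑ (allLists k vs) (λ β → G (a ∷ β)))
∑-allLists-suc k vs G =
  trans (∑-concatMap (λ a → map (a ∷_) (allLists k vs)) vs G) (∑-cong vs (λ a → ∑-map (a ∷_) (allLists k vs) G))

∑-allLists-∷ʳ : ∀ k vs G →
  ∑ (allLists (suc k) vs) G ≡ ∑ (allLists k vs) (λ β → ∑ vs (λ b → G (β ∷ʳ b)))
∑-allLists-∷ʳ zero vs G =
  trans (∑-allLists-suc zero vs G)
        (trans (∑-cong vs (λ a → ℤP.+-identityʳ (G (a ∷ [])))) (sym (ℤP.+-identityʳ _)))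
∑-allLists-∷ʳ (suc k) vs G =
  trans (∑-allLists-suc (suc k) vs G)
        (trans (∑-cong vs (λ a → ∑-allLists-∷ʳ k vs (λ γ → G (a ∷ γ))))
               (sym (∑-allLists-suc k vs (λ β → ∑ vs (λ b → G (β ∷ʳ b))))))

∑-allLists-map : ∀ k (f : ℕ → ℕ) vs G → ∑ (allLists k vs) (G ∘ map f) ≡ ∑ (allLists k (map f vs)) G
∑-allLists-map zero f vs G = refl
∑-allLists-map (suc k) f vs G = begin
  ∑ (allLists (suc k) vs) (G ∘ map f)
    ≡⟨ ∑-allLists-suc k vs (G ∘ map f) ⟩
  ∑ vs (λ a → ∑ (allLists k vs) (λ β → G (f a ∷ map f β)))
    ≡⟨ ∑-cong vs (λ a → ∑-allLists-map k f vs (λ β → G (f a ∷ β))) ⟩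
  ∑ vs (λ a → ∑ (allLists k (map f vs)) (λ β → G (f a ∷ β)))
    ≡⟨ sym (∑-map f vs (λ b → ∑ (allLists k (map f vs)) (λ β → G (b ∷ β)))) ⟩
  ∑ (map f vs) (λ b → ∑ (allLists k (map f vs)) (λ β → G (b ∷ β)))
    ≡⟨ sym (∑-allLists-suc k (map f vs) G) ⟩
  ∑ (allLists (suc k) (map f vs)) G ∎
  where open ≡-Reasoning

∑-allLists-cong : ∀ {vs vs′} → (∀ g → ∑ vs g ≡ ∑ vs′ g) →
  ∀ k G → ∑ (allLists k vs) G ≡ ∑ (allLists k vs′) G
∑-allLists-cong vs≈vs′ zero G = refl
∑-allLists-cong {vs} {vs′} vs≈vs′ (suc k) G =
  trans (∑-allLists-suc k vs G)
        (trans (∑-cong vs (λ a → ∑-allLists-cong vs≈vs′ k (λ β → G (a ∷ β))))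
               (trans (vs≈vs′ _) (sym (∑-allLists-suc k vs′ G))))

∑-allLists-reverse : ∀ k vs G → ∑ (allLists k vs) (G ∘ reverse) ≡ ∑ (allLists k vs) G
∑-allLists-reverse zero vs G = refl
∑-allLists-reverse (suc k) vs G = begin
  ∑ (allLists (suc k) vs) (G ∘ reverse)
    ≡⟨ ∑-allLists-∷ʳ k vs (G ∘ reverse) ⟩
  ∑ (allLists k vs) (λ β → ∑ vs (λ b → G (reverse (β ∷ʳ b))))
    ≡⟨ ∑-cong (allLists k vs) (λ β → ∑-cong vs (λ b → cong G (ListP.reverse-++ β (b ∷ [])))) ⟩
  ∑ (allLists k vs) (λ β → ∑ vs (λ b → G (b ∷ reverse β)))
    ≡⟨ ∑-comm (allLists k vs) vs (λ β b → G (b ∷ reverse β)) ⟩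
  ∑ vs (λ b → ∑ (allLists k vs) (λ β → G (b ∷ reverse β)))
    ≡⟨ ∑-cong vs (λ b → ∑-allLists-reverse k vs (λ β → G (b ∷ β))) ⟩
  ∑ vs (λ b → ∑ (allLists k vs) (λ β → G (b ∷ β)))
    ≡⟨ sym (∑-allLists-suc k vs G) ⟩
  ∑ (allLists (suc k) vs) G ∎
  where open ≡-Reasoning

allLists-All : ∀ {P : ℕ → Set} k {vs} → All P vs → All (λ α → All P α × length α ≡ k) (allLists k vs)
allLists-All zero _ = ([] , refl) ∷ []
allLists-All {P} (suc k) {vs} Pvs = AllP.concat⁺ (AllP.map⁺ (All.map extend Pvs))
  where
  extend : ∀ {a} → P a → All (λ α → All P α × length α ≡ suc k) (map (a ∷_) (allLists k vs))
  extend Pa = AllP.map⁺ (All.map (λ (Pα , |α|) → Pa ∷ Pα , cong suc |α|) (allLists-All k Pvs))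

values : ℕ → List ℕ
values m = map suc (upTo (suc m))

values-tuple : ∀ m → Tuple m (values m)
values-tuple m = AllP.map⁺ (AllP.applyUpTo⁺₁ (λ i → i) (suc m) λ { (s≤s i≤m) → s≤s z≤n , s≤s i≤m })

∑-values-mirror : ∀ m g → ∑ (map (m ℕ.+ 2 ∸_) (values m)) g ≡ ∑ (values m) g
∑-values-mirror m g = begin
  ∑ (map ρ (values m)) g                   ≡⟨ ∑-map ρ (values m) g ⟩
  ∑ (values m) (g ∘ ρ)                     ≡⟨ ∑-map suc (upTo (suc m)) (g ∘ ρ) ⟩
  ∑ (upTo (suc m)) (g ∘ ρ ∘ suc)           ≡⟨ ∑-applyUpTo (λ i → i) (suc m) (g ∘ ρ ∘ suc) ⟩
  ∑< (suc m) (g ∘ ρ ∘ suc)                 ≡⟨ ∑<-cong (suc m) reflected ⟩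
  ∑< (suc m) (λ i → g (suc (suc m ∸ suc i))) ≡⟨ ∑<-reverse (suc m) (g ∘ suc) ⟩
  ∑< (suc m) (g ∘ suc)                     ≡⟨ sym (∑-applyUpTo (λ i → i) (suc m) (g ∘ suc)) ⟩
  ∑ (upTo (suc m)) (g ∘ suc)               ≡⟨ sym (∑-map suc (upTo (suc m)) g) ⟩
  ∑ (values m) g                           ∎
  where
  open ≡-Reasoning
  ρ = m ℕ.+ 2 ∸_
  reflected : ∀ i → i < suc m → g (ρ (suc i)) ≡ g (suc (suc m ∸ suc i))
  reflected i (s≤s i≤m) = cong g (trans (cong (_∸ suc i) (ℕP.+-comm m 2)) (ℕP.+-∸-assoc 1 i≤m))

∑-allLists-mirror : ∀ m k G → ∑ (allLists k (values m)) (G ∘ mirror m) ≡ ∑ (allLists k (values m)) G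
∑-allLists-mirror m k G = begin
  ∑ (allLists k (values m)) (G ∘ reverse ∘ map (m ℕ.+ 2 ∸_))
    ≡⟨ ∑-allLists-map k (m ℕ.+ 2 ∸_) (values m) (G ∘ reverse) ⟩
  ∑ (allLists k (map (m ℕ.+ 2 ∸_) (values m))) (G ∘ reverse)
    ≡⟨ ∑-allLists-cong (∑-values-mirror m) k (G ∘ reverse) ⟩
  ∑ (allLists k (values m)) (G ∘ reverse)
    ≡⟨ ∑-allLists-reverse k (values m) G ⟩
  ∑ (allLists k (values m)) G ∎
  where open ≡-Reasoning

tuples-symbol-reflect : ∀ m k s →
  ∑ (tuples m (suc k)) (λ α → summandSymbol m (suc k) α (+ k - + 1 - s))
  ≡ (- + 1) ^ m * ∑ (tuples m (suc k)) (λ α → summandSymbol m (suc k) α s)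
tuples-symbol-reflect m k s = begin
  ∑ (filterᵇ gapChain Λ) (λ α → summandSymbol m (suc k) α s′)
    ≡⟨ ∑-filterᵇ Λ gapChain _ ⟩
  ∑ Λ (λ α → if gapChain α then summandSymbol m (suc k) α s′ else + 0)
    ≡⟨ ∑-cong-local (All.map pointwise (allLists-All (suc k) (values-tuple m))) ⟩
  ∑ Λ (λ α → (- + 1) ^ m * H (mirror m α))
    ≡⟨ ∑-*ˡ Λ ((- + 1) ^ m) (H ∘ mirror m) ⟩
  (- + 1) ^ m * ∑ Λ (H ∘ mirror m)
    ≡⟨ cong ((- + 1) ^ m *_) (∑-allLists-mirror m (suc k) H) ⟩
  (- + 1) ^ m * ∑ Λ H
    ≡⟨ cong ((- + 1) ^ m *_) (sym (∑-filterᵇ Λ gapChain (λ α → summandSymbol m (suc k) α s))) ⟩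
  (- + 1) ^ m * ∑ (filterᵇ gapChain Λ) (λ α → summandSymbol m (suc k) α s) ∎
  where
  open ≡-Reasoning
  Λ = allLists (suc k) (values m)
  s′ = + k - + 1 - s
  H : List ℕ → ℤ
  H α = if gapChain α then summandSymbol m (suc k) α s else + 0
  pointwise : ∀ {α} → Tuple m α × length α ≡ suc k →
    (if gapChain α then summandSymbol m (suc k) α s′ else + 0) ≡ (- + 1) ^ m * H (mirror m α)
  pointwise {α} (tuple , |α|) rewrite gapChain-mirror m α (tuple-bounded tuple) with gapChain α in gaps
  ... | true = summandSymbol-mirror m k s α tuple |α| gaps
  ... | false = sym (ℤP.*-zeroʳ ((- + 1) ^ m))

-- The operator L̃ₘ

homogeneous-layer : ∀ m k →
  Homogeneous (+ 1 - + suc k) (λ s → ∑ (tuples m (suc k)) (λ α → summandSymbol m (suc k) α s))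
              (uPow (+ 1 - + suc k) ⊗ sumOps (map (summand m (suc k)) (tuples m (suc k))))
homogeneous-layer m k =
  homogeneous-cong refl (λ s → ℤP.*-identityˡ _)
    (homogeneous-⊗₀ (homogeneous-monomial (+ 1) (+ 1 - + suc k))
      (homogeneous-sumOps (summand m (suc k)) (summandSymbol m (suc k))
        (AllP.filter⁺ (T? ∘ gapChain) (All.map summand-hom (allLists-All (suc k) (values-tuple m))))))
  where
  summand-hom : ∀ {α} → Tuple m α × length α ≡ suc k →
    Homogeneous (+ 0) (summandSymbol m (suc k) α) (summand m (suc k) α)
  summand-hom {[]} (_ , ())
  summand-hom {a ∷ α} _ = homogeneous-summand m (suc k) a α

outer-symmetric : ∀ m K → Symmetric ((- + 1) ^ m) (outer m K)
outer-symmetric m zero = symmetric-[] ((- + 1) ^ m)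
outer-symmetric m (suc k) = symmetric-⊕ (outer-symmetric m k) (homogeneous⇒symmetric (homogeneous-layer m k) λ s →
  trans (∑-cong (tuples m (suc k)) (λ α → cong (summandSymbol m (suc k) α) (shift s (+ k))))
        (tuples-symbol-reflect m k s))
  where
  shift : ∀ s k → - s - (+ 1 - (+ 1 + k)) - + 1 ≡ k - + 1 - s
  shift = solve-∀

Ltilde-symmetric : ∀ m → Symmetric ((- + 1) ^ m) (Ltilde m)
Ltilde-symmetric m = symmetric-⊕ (leading-symmetric m) (outer-symmetric m (suc ⌊ m /2⌋))

proposition2p4 : (m : ℕ) → 2 ≤ m →
    adjoint (Ltilde m) ≈op scale ((- (+ 1)) ^ m) (Ltilde m)
proposition2p4 m _ = symmetric⇒adjoint≈op (Ltilde-symmetric m)
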